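{- Let $k\ge2$ be such that $T_k(x)=x^k+x+1$ is primitive over $\mathbb{F}_2$, let $M_k$ be the binary cyclic word defined below, and let $U$ be the rotation of $M_k$ that starts with $0^k$. Let $U_{\mathrm{lin}}=U\,U[0..k-2]$. Then \[\operatorname{BWT}(U_{\mathrm{lin}}\$)=0^{k-1}\,1\,\$\,(0011)^{2^{k-2}-1}\,010,\] and this string has $r=2^{k-1}+4$ runs.
   Context: Binary alphabet $\{0,1\}$ with $0<1$; $\oplus$ is addition mod 2. Define $F':\{0,1\}^k\to\{0,1\}^k$ by $F'(x_0,\dots,x_{k-1})=(x_1,\dots,x_{k-1},\,x_0\oplus x_1\oplus\delta(x))$, where $\delta(x)=1$ if $x\in\{0^k,10^{k-1}\}$ and $0$ otherwise. Let $y_0=0^k$, $y_{t+1}=F'(y_t)$, $s_t$ the first coordinate of $y_t$, and $D_k$ the cyclic word $s_0\cdots s_{2^k-1}$ (a binary de Bruijn sequence of order $k$: every binary word of length $k$ occurs exactly once as a cyclic window). $M_k$ is obtained from $D_k$ by reversing it and complementing every bit; it is again de Bruijn, so exactly one rotation starts with $0^k$. Strings are 0-indexed; $U[0..k-2]$ is the length-$(k-1)$ prefix of $U$. $\$\notin\{0,1\}$ is an end-marker smaller than $0$, and $w\$$ is $w$ followed by one $\$$. $\operatorname{BWT}(w\$)$ is the last column of the matrix of lexicographically sorted cyclic rotations of $w\$$. A run is a maximal block of equal consecutive letters. -}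

module Defs where

open import Data.Bool using (Bool; true; false; _xor_; not; if_then_else_; _∧_)
open import Data.Nat using (ℕ; zero; suc; _+_; _∸_; _^_; _<_; _≤_)
open import Data.List using (List; []; _∷_; _++_; [_]; map; replicate; take; drop; reverse; concat; upTo; length)
open import Data.Product using (∃; _×_)
open import Data.Sum using (_⊎_)
open import Relation.Binary.PropositionalEquality using (_≡_)
open import Relation.Nullary using (¬_)

-- Polynomials over F₂: coefficient lists (index i = coefficient of xⁱ),
-- compared up to trailing zeros.

Poly : Set
Poly = List Bool

coeff : Poly → ℕ → Bool
coeff []       _       = false
coeff (a ∷ p)  zero    = a
coeff (a ∷ p)  (suc i) = coeff p i

_≈ₚ_ : Poly → Poly → Set
p ≈ₚ q = ∀ i → coeff p i ≡ coeff q i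

addP : Poly → Poly → Poly
addP []       q        = q
addP p        []       = p
addP (a ∷ p)  (b ∷ q)  = (a xor b) ∷ addP p q

mulP : Poly → Poly → Poly
mulP []       q = []
mulP (a ∷ p)  q = addP (if a then q else []) (false ∷ mulP p q)

xpow : ℕ → Poly
xpow n = replicate n false ++ [ true ]

oneP : Poly
oneP = xpow 0

_∣ₚ_ : Poly → Poly → Set
f ∣ₚ g = ∃ λ h → g ≈ₚ mulP f h

-- irreducible over F₂ (the only unit of F₂[x] is 1; f is not a unit/zero)
Irreducible : Poly → Set
Irreducible f = ¬ (f ≈ₚ []) × ¬ (f ≈ₚ oneP) ×
  (∀ a b → f ≈ₚ mulP a b → (a ≈ₚ oneP) ⊎ (b ≈ₚ oneP))

-- primitive polynomial of degree k over F₂: irreducible, and its roots have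
-- multiplicative order 2ᵏ − 1, i.e. 2ᵏ−1 is the least e > 0 with f ∣ xᵉ − 1.
Primitive : ℕ → Poly → Set
Primitive k f = Irreducible f
  × f ∣ₚ addP (xpow (2 ^ k ∸ 1)) oneP
  × (∀ e → 0 < e → e < 2 ^ k ∸ 1 → ¬ (f ∣ₚ addP (xpow e) oneP))

T : ℕ → Poly
T k = addP (addP (xpow k) (xpow 1)) oneP

-- F'(x₀,…,x_{k-1}) = (x₁,…,x_{k-1}, x₀ ⊕ x₁ ⊕ δ(x)),
-- δ(x) = 1 iff x ∈ {0ᵏ, 10^{k-1}} iff x₁ = … = x_{k-1} = 0.
allZero : List Bool → Bool
allZero []      = true
allZero (b ∷ r) = not b ∧ allZero r

F' : List Bool → List Bool
F' (x₀ ∷ x₁ ∷ r) =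
  x₁ ∷ r ++ [ (x₀ xor x₁) xor (if allZero (x₁ ∷ r) then true else false) ]
F' xs = xs   -- only used for k ≥ 2

iter : ℕ → (List Bool → List Bool) → List Bool → List Bool
iter zero    f x = x
iter (suc n) f x = f (iter n f x)

headB : List Bool → Bool
headB []      = false
headB (b ∷ _) = b

s : ℕ → ℕ → Bool
s k t = headB (iter t F' (replicate k false))

D : ℕ → List Bool
D k = map (s k) (upTo (2 ^ k))

M : ℕ → List Bool
M k = map not (reverse (D k))

rotate : {A : Set} → ℕ → List A → List A
rotate i xs = drop i xs ++ take i xs

-- BWT over the alphabet {$, 0, 1} with $ < 0 < 1

data Sym : Set where
  end : Sym
  bit : Bool → Sym

_<ˢ_ : Sym → Sym → Bool
end   <ˢ end   = false
end   <ˢ bit _ = true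
bit _ <ˢ end   = false
bit false <ˢ bit true = true
bit _ <ˢ bit _ = false

_==ˢ_ : Sym → Sym → Bool
end   ==ˢ end   = true
end   ==ˢ bit _ = false
bit _ ==ˢ end   = false
bit a ==ˢ bit b = not (a xor b)

lexLeq : List Sym → List Sym → Bool
lexLeq []       _        = true
lexLeq (_ ∷ _)  []       = false
lexLeq (a ∷ u)  (b ∷ v)  = if a <ˢ b then true else (if a ==ˢ b then lexLeq u v else false)

insert : List Sym → List (List Sym) → List (List Sym)
insert x []       = [ x ]
insert x (y ∷ ys) = if lexLeq x y then x ∷ y ∷ ys else y ∷ insert x ys

isort : List (List Sym) → List (List Sym)
isort []       = []
isort (x ∷ xs) = insert x (isort xs)

lastS : List Sym → Sym
lastS []           = end
lastS (a ∷ [])     = a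
lastS (_ ∷ b ∷ r)  = lastS (b ∷ r)

rotations : List Sym → List (List Sym)
rotations w = map (λ i → rotate i w) (upTo (length w))

BWT : List Sym → List Sym
BWT w = map lastS (isort (rotations w))

runs : List Sym → ℕ
runs []            = 0
runs (_ ∷ [])      = 1
runs (a ∷ b ∷ r)   = (if a ==ˢ b then 0 else 1) + runs (b ∷ r)

withEnd : List Bool → List Sym
withEnd w = map bit w ++ [ end ]

target : ℕ → List Sym
target k = replicate (k ∸ 1) (bit false) ++ bit true ∷ end ∷
  concat (replicate (2 ^ (k ∸ 2) ∸ 1) (bit false ∷ bit false ∷ bit true ∷ bit true ∷ []))
  ++ bit false ∷ bit true ∷ bit false ∷ []

-- Off the states 0ᵏ and 10^{k-1}, F' is the linear feedback shift register of Tₖ, whose output obeys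
-- s(t + k) = s(t) ⊕ s(t + 1). Primitivity of Tₖ makes all 2ᵏ - 1 nonzero states of that register lie on
-- one cycle (a shorter return would make the impulse sequence periodic with a period e < 2ᵏ - 1, and then
-- Tₖ ∣ xᵉ + 1), so F' runs through all 2ᵏ states and the 2ᵏ windows of length k of U are exactly the
-- words of {0,1}ᵏ. Hence the length-k prefixes of the rotations of U U[0..k-2]$ are pairwise distinct:
-- the words of {0,1}ᵏ and the k words 0ᵃ$0^{k-1-a}. Sorting the rotations therefore sorts these prefixes,
-- and the BWT lists, in lexicographic order of the prefixes, the letter preceding each one. Since M is D
-- reversed and complemented, that letter is obtained by running F' backwards on the window, and evaluating
-- it over all words in lexicographic order (by induction on the word length) gives
-- 0^{k-1} 1 $ (0011)^{2^{k-2}-1} 010.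

module Submission where

open import Defs
open import Algebra.Bundles using (CommutativeRing)
open import Data.Bool using (Bool; true; false; _xor_; not; if_then_else_; _∧_)
open import Data.Bool.Properties
  using (xor-∧-commutativeRing; xor-identityʳ; xor-same; xor-comm; xor-assoc;
         ∧-distribˡ-xor; ∧-distribʳ-xor; ∧-identityʳ; ∧-zeroʳ; ∧-assoc; ∧-comm; not-involutive)
  renaming (_≟_ to _≟ᵇ_)
open import Data.Empty using (⊥-elim)
open import Data.List
  using (List; []; _∷_; _++_; [_]; map; replicate; take; drop; reverse; length; applyUpTo; concat; upTo; filter)
open import Data.Bool.ListAction using (and)
import Data.List.Properties as List
open import Data.List.Membership.Propositional using (_∈_)
open import Data.List.Membership.Propositional.Properties
  using (∈-map⁺; ∈-map⁻; ∈-++⁺ˡ; ∈-++⁺ʳ; ∈-++⁻; ∈-filter⁺; ∈-applyUpTo⁺; ∈-applyUpTo⁻)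
open import Data.List.Relation.Unary.All as All using (All; []; _∷_)
open import Data.List.Relation.Unary.AllPairs as AllPairs using (AllPairs; []; _∷_)
import Data.List.Relation.Unary.AllPairs.Properties as AllPairs
open import Data.List.Relation.Unary.Any using (Any; here; there)
open import Data.List.Relation.Unary.Unique.Propositional using (Unique)
import Data.List.Relation.Unary.Unique.Propositional.Properties as Unique
open import Data.Nat
  using (ℕ; zero; suc; _+_; _∸_; _*_; _^_; _<_; _≤_; _≡ᵇ_; z≤n; s≤s; _<?_)
open import Data.Nat.Properties
open import Data.Nat.Tactic.RingSolver using (solve-∀)
open import Data.Product using (_×_; _,_; proj₁; proj₂; ∃)
open import Data.Sum using (_⊎_; inj₁; inj₂)
open import Function using (_∘_)
open import Relation.Binary.Definitions using (Tri; tri<; tri≈; tri>; DecidableEquality)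
open import Relation.Binary.PropositionalEquality hiding ([_])
open import Relation.Nullary using (¬_; yes; no; ¬?; contradiction)

private
  variable
    A B : Set

xor-interchange : ∀ a b c d → (a xor b) xor (c xor d) ≡ (a xor c) xor (b xor d)
xor-interchange = interchange
  where
  open import Algebra.Properties.CommutativeSemigroup
    (CommutativeRing.+-commutativeSemigroup xor-∧-commutativeRing) using (interchange)

xor≡false⇒≡ : ∀ a b → a xor b ≡ false → a ≡ b
xor≡false⇒≡ true  true  _ = refl
xor≡false⇒≡ false false _ = refl

true≢false : true ≢ false
true≢false ()

xor-cancelʳ : ∀ a b c → a xor c ≡ b xor c → a ≡ b
xor-cancelʳ true  true  _     _  = refl
xor-cancelʳ false false _     _  = refl
xor-cancelʳ true  false false ()
xor-cancelʳ true  false true  ()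
xor-cancelʳ false true  false ()
xor-cancelʳ false true  true  ()

not-xor-not : ∀ a b c → not (not a xor (not b xor c)) ≡ not (a xor b) xor c
not-xor-not true  true  true  = refl
not-xor-not true  true  false = refl
not-xor-not true  false true  = refl
not-xor-not true  false false = refl
not-xor-not false true  true  = refl
not-xor-not false true  false = refl
not-xor-not false false true  = refl
not-xor-not false false false = refl

if-true-false : ∀ b → (if b then true else false) ≡ b
if-true-false true  = refl
if-true-false false = refl

≡ᵇ-refl : ∀ a → (a ≡ᵇ a) ≡ true
≡ᵇ-refl zero    = refl
≡ᵇ-refl (suc a) = ≡ᵇ-refl a

<⇒≡ᵇ-false : ∀ a b → a < b → (a ≡ᵇ b) ≡ false
<⇒≡ᵇ-false zero    (suc b) _       = refl
<⇒≡ᵇ-false (suc a) (suc b) (s≤s p) = <⇒≡ᵇ-false a b p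

∸-≡ : ∀ a b c → a ≡ c + b → a ∸ b ≡ c
∸-≡ a b c e = trans (cong (_∸ b) e) (m+n∸n≡m c b)

and-++ : ∀ xs ys → and (xs ++ ys) ≡ and xs ∧ and ys
and-++ []       ys = refl
and-++ (b ∷ xs) ys = trans (cong (b ∧_) (and-++ xs ys)) (sym (∧-assoc b (and xs) (and ys)))

and-reverse : ∀ xs → and (reverse xs) ≡ and xs
and-reverse []       = refl
and-reverse (b ∷ xs) = begin
  and (reverse (b ∷ xs))        ≡⟨ cong and (List.unfold-reverse b xs) ⟩
  and (reverse xs ++ [ b ])     ≡⟨ and-++ (reverse xs) [ b ] ⟩
  and (reverse xs) ∧ (b ∧ true) ≡⟨ cong₂ _∧_ (and-reverse xs) (∧-identityʳ b) ⟩
  and xs ∧ b                    ≡⟨ ∧-comm (and xs) b ⟩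
  b ∧ and xs ∎
  where open ≡-Reasoning

allZero≡and-map-not : ∀ xs → allZero xs ≡ and (map not xs)
allZero≡and-map-not []       = refl
allZero≡and-map-not (b ∷ xs) = cong (not b ∧_) (allZero≡and-map-not xs)

allZero-replicate : ∀ n → allZero (replicate n false) ≡ true
allZero-replicate zero    = refl
allZero-replicate (suc n) = allZero-replicate n

allZero⇒replicate : ∀ v → allZero v ≡ true → v ≡ replicate (length v) false
allZero⇒replicate []          _ = refl
allZero⇒replicate (false ∷ v) h = cong (false ∷_) (allZero⇒replicate v h)

replicate-∷ʳ : ∀ n (a : A) → replicate n a ++ [ a ] ≡ replicate (suc n) a
replicate-∷ʳ zero    a = refl
replicate-∷ʳ (suc n) a = cong (a ∷_) (replicate-∷ʳ n a)

∷ʳ≢[] : ∀ (r : List A) {c} → r ++ [ c ] ≢ []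
∷ʳ≢[] r e with () ← List.++-conicalʳ r _ e

applyUpTo-cong : ∀ {f g : ℕ → A} → (∀ a → f a ≡ g a) → ∀ n → applyUpTo f n ≡ applyUpTo g n
applyUpTo-cong f≗g zero    = refl
applyUpTo-cong f≗g (suc n) = cong₂ _∷_ (f≗g 0) (applyUpTo-cong (f≗g ∘ suc) n)

applyUpTo-≡ᵇ : ∀ n → applyUpTo (λ a → bit (a ≡ᵇ n)) (suc n) ≡ replicate n (bit false) ++ [ bit true ]
applyUpTo-≡ᵇ zero    = refl
applyUpTo-≡ᵇ (suc n) = cong (bit false ∷_) (applyUpTo-≡ᵇ n)

nth : A → List A → ℕ → A
nth d []       _       = d
nth d (x ∷ xs) zero    = x
nth d (x ∷ xs) (suc j) = nth d xs j

headB-nth : ∀ xs → headB xs ≡ nth false xs 0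
headB-nth []      = refl
headB-nth (x ∷ xs) = refl

nth-ext : (d : A) (xs ys : List A) → length xs ≡ length ys →
          (∀ j → j < length xs → nth d xs j ≡ nth d ys j) → xs ≡ ys
nth-ext d []       []       _ _ = refl
nth-ext d (x ∷ xs) (y ∷ ys) e h =
  cong₂ _∷_ (h 0 (s≤s z≤n)) (nth-ext d xs ys (suc-injective e) (λ j p → h (suc j) (s≤s p)))

nth-applyUpTo : (d : A) (f : ℕ → A) (n j : ℕ) → j < n → nth d (applyUpTo f n) j ≡ f j
nth-applyUpTo d f (suc n) zero    _       = refl
nth-applyUpTo d f (suc n) (suc j) (s≤s p) = nth-applyUpTo d (f ∘ suc) n j p

nth-++ˡ : (d : A) (xs ys : List A) (j : ℕ) → j < length xs → nth d (xs ++ ys) j ≡ nth d xs j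
nth-++ˡ d (x ∷ xs) ys zero    _       = refl
nth-++ˡ d (x ∷ xs) ys (suc j) (s≤s p) = nth-++ˡ d xs ys j p

nth-++ʳ : (d : A) (xs ys : List A) (j : ℕ) → nth d (xs ++ ys) (length xs + j) ≡ nth d ys j
nth-++ʳ d []       ys j = refl
nth-++ʳ d (x ∷ xs) ys j = nth-++ʳ d xs ys j

nth-++ʳ-∸ : (d : A) (xs ys : List A) (j : ℕ) → length xs ≤ j →
            nth d (xs ++ ys) j ≡ nth d ys (j ∸ length xs)
nth-++ʳ-∸ d []       ys j       _       = refl
nth-++ʳ-∸ d (x ∷ xs) ys (suc j) (s≤s p) = nth-++ʳ-∸ d xs ys j p

nth-drop : (d : A) (xs : List A) (p j : ℕ) → nth d (drop p xs) j ≡ nth d xs (p + j)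
nth-drop d []       zero    j = refl
nth-drop d []       (suc p) j = refl
nth-drop d (x ∷ xs) zero    j = refl
nth-drop d (x ∷ xs) (suc p) j = nth-drop d xs p j

nth-take : (d : A) (xs : List A) (p j : ℕ) → j < p → nth d (take p xs) j ≡ nth d xs j
nth-take d []       (suc p) j       _       = refl
nth-take d (x ∷ xs) (suc p) zero    _       = refl
nth-take d (x ∷ xs) (suc p) (suc j) (s≤s q) = nth-take d xs p j q

nth-map : (d : A) (e : B) (f : A → B) (xs : List A) (j : ℕ) → j < length xs →
          nth e (map f xs) j ≡ f (nth d xs j)
nth-map d e f (x ∷ xs) zero    _       = refl
nth-map d e f (x ∷ xs) (suc j) (s≤s p) = nth-map d e f xs j p

nth-replicate : (d a : A) (n j : ℕ) → j < n → nth d (replicate n a) j ≡ a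
nth-replicate d a (suc n) zero    _       = refl
nth-replicate d a (suc n) (suc j) (s≤s p) = nth-replicate d a n j p

nth-reverse : (d : A) (xs : List A) (j : ℕ) → j < length xs →
              nth d (reverse xs) j ≡ nth d xs (length xs ∸ suc j)
nth-reverse d (x ∷ xs) j p rewrite List.unfold-reverse x xs with j <? length xs
... | yes j<xs = begin
  nth d (reverse xs ++ [ x ]) j
    ≡⟨ nth-++ˡ d (reverse xs) [ x ] j (subst (j <_) (sym (List.length-reverse xs)) j<xs) ⟩
  nth d (reverse xs) j
    ≡⟨ nth-reverse d xs j j<xs ⟩
  nth d xs (length xs ∸ suc j)
    ≡⟨ cong (nth d (x ∷ xs)) (sym (+-∸-assoc 1 j<xs)) ⟩
  nth d (x ∷ xs) (suc (length xs) ∸ suc j) ∎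
  where open ≡-Reasoning
... | no j≮xs = begin
  nth d (reverse xs ++ [ x ]) j
    ≡⟨ cong (nth d (reverse xs ++ [ x ])) j≡ ⟩
  nth d (reverse xs ++ [ x ]) (length (reverse xs) + 0)
    ≡⟨ nth-++ʳ d (reverse xs) [ x ] 0 ⟩
  x
    ≡⟨ cong (nth d (x ∷ xs)) (sym (m≤n⇒m∸n≡0 (≮⇒≥ j≮xs))) ⟩
  nth d (x ∷ xs) (length xs ∸ j) ∎
  where
  open ≡-Reasoning
  j≡ : j ≡ length (reverse xs) + 0
  j≡ = trans (≤-antisym (≤-pred p) (≮⇒≥ j≮xs)) (sym (trans (+-identityʳ _) (List.length-reverse xs)))

length-rotate : ∀ i (xs : List A) → i ≤ length xs → length (rotate i xs) ≡ length xs
length-rotate i xs p = begin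
  length (drop i xs ++ take i xs)
    ≡⟨ List.length-++ (drop i xs) ⟩
  length (drop i xs) + length (take i xs)
    ≡⟨ cong₂ _+_ (List.length-drop i xs) (trans (List.length-take i xs) (m≤n⇒m⊓n≡m p)) ⟩
  length xs ∸ i + i
    ≡⟨ m∸n+n≡m p ⟩
  length xs ∎
  where open ≡-Reasoning

nth-rotate-< : (d : A) (i : ℕ) (xs : List A) (j : ℕ) → i + j < length xs →
               nth d (rotate i xs) j ≡ nth d xs (i + j)
nth-rotate-< d i xs j p =
  trans (nth-++ˡ d (drop i xs) (take i xs) j (subst (j <_) (sym (List.length-drop i xs)) j<))
        (nth-drop d xs i j)
  where
  j< : j < length xs ∸ i
  j< = subst (_< length xs ∸ i) (m+n∸m≡n i j) (∸-monoˡ-< p (m≤m+n i j))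

nth-rotate-≥ : (d : A) (i : ℕ) (xs : List A) (j e : ℕ) → i ≤ length xs →
               i + j ≡ length xs + e → e < i → nth d (rotate i xs) j ≡ nth d xs e
nth-rotate-≥ d i xs j e p q e<i = begin
  nth d (rotate i xs) j                        ≡⟨ cong (nth d (rotate i xs)) j≡ ⟩
  nth d (rotate i xs) (length (drop i xs) + e) ≡⟨ nth-++ʳ d (drop i xs) (take i xs) e ⟩
  nth d (take i xs) e                          ≡⟨ nth-take d xs i e e<i ⟩
  nth d xs e ∎
  where
  open ≡-Reasoning
  j≡ : j ≡ length (drop i xs) + e
  j≡ = +-cancelˡ-≡ i j _ (begin
    i + j                   ≡⟨ q ⟩
    length xs + e           ≡⟨ cong (_+ e) (sym (m+[n∸m]≡n p)) ⟩
    i + (length xs ∸ i) + e ≡⟨ +-assoc i _ e ⟩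
    i + (length xs ∸ i + e) ≡⟨ cong (λ l → i + (l + e)) (sym (List.length-drop i xs)) ⟩
    i + (length (drop i xs) + e)  ∎)

module _ {A : Set} (_≟_ : DecidableEquality A) where

  open import Data.List.Membership.DecPropositional _≟_ using (_∈?_)

  unique-⊆⇒length≤ : ∀ xs ys → Unique xs → (∀ {x} → x ∈ xs → x ∈ ys) → length xs ≤ length ys
  unique-⊆⇒length≤ []       ys _          _   = z≤n
  unique-⊆⇒length≤ (x ∷ xs) ys (x∉ ∷ u) sub =
    <-≤-trans (s≤s (unique-⊆⇒length≤ xs ys′ u sub′)) (List.filter-notAll (¬? ∘ (_≟ x)) ys (x∈⇒ (sub (here refl))))
    where
    ys′ = filter (¬? ∘ (_≟ x)) ys
    sub′ : ∀ {z} → z ∈ xs → z ∈ ys′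
    sub′ z∈ = ∈-filter⁺ (¬? ∘ (_≟ x)) (sub (there z∈)) (λ z≡x → All.lookup x∉ z∈ (sym z≡x))
    x∈⇒ : ∀ {zs} → x ∈ zs → Any (λ z → ¬ ¬ z ≡ x) zs
    x∈⇒ (here refl) = here λ z≢x → z≢x refl
    x∈⇒ (there q)   = there (x∈⇒ q)

  unique-⊆-length≡⇒⊇ : ∀ xs ys → Unique xs → (∀ {x} → x ∈ xs → x ∈ ys) →
                       length xs ≡ length ys → ∀ {y} → y ∈ ys → y ∈ xs
  unique-⊆-length≡⇒⊇ xs ys u sub len {y} y∈ with y ∈? xs
  ... | yes y∈xs = y∈xs
  ... | no  y∉xs = ⊥-elim (<-irrefl len (unique-⊆⇒length≤ (y ∷ xs) ys (All.tabulate y≢ ∷ u) sub′))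
    where
    y≢ : ∀ {z} → z ∈ xs → y ≢ z
    y≢ z∈ refl = y∉xs z∈
    sub′ : ∀ {z} → z ∈ y ∷ xs → z ∈ ys
    sub′ (here refl) = y∈
    sub′ (there z∈)  = sub z∈

rank : Sym → ℕ
rank end         = 0
rank (bit false) = 1
rank (bit true)  = 2

rank-injective : ∀ a b → rank a ≡ rank b → a ≡ b
rank-injective end         end         _ = refl
rank-injective (bit false) (bit false) _ = refl
rank-injective (bit true)  (bit true)  _ = refl
rank-injective end         (bit false) ()
rank-injective end         (bit true)  ()
rank-injective (bit false) end         ()
rank-injective (bit false) (bit true)  ()
rank-injective (bit true)  end         ()
rank-injective (bit true)  (bit false) ()

_≤ˡ_ _<ˡ_ : List Sym → List Sym → Set
x ≤ˡ y = lexLeq x y ≡ true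
x <ˡ y = lexLeq y x ≡ false

lexLeq-∷⁻ : ∀ a b u v → (a ∷ u) ≤ˡ (b ∷ v) → rank a < rank b ⊎ (a ≡ b × u ≤ˡ v)
lexLeq-∷⁻ end         end         u v h = inj₂ (refl , h)
lexLeq-∷⁻ end         (bit false) u v h = inj₁ (s≤s z≤n)
lexLeq-∷⁻ end         (bit true)  u v h = inj₁ (s≤s z≤n)
lexLeq-∷⁻ (bit false) (bit false) u v h = inj₂ (refl , h)
lexLeq-∷⁻ (bit false) (bit true)  u v h = inj₁ (s≤s (s≤s z≤n))
lexLeq-∷⁻ (bit true)  (bit true)  u v h = inj₂ (refl , h)

lexLeq-rank< : ∀ a b u v → rank a < rank b → (a ∷ u) ≤ˡ (b ∷ v)
lexLeq-rank< end         (bit false) u v p = refl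
lexLeq-rank< end         (bit true)  u v p = refl
lexLeq-rank< (bit false) (bit true)  u v p = refl
lexLeq-rank< (bit false) (bit false) u v (s≤s ())
lexLeq-rank< (bit true)  (bit false) u v (s≤s ())
lexLeq-rank< (bit true)  (bit true)  u v (s≤s (s≤s ()))

lexLeq-∷ : ∀ a u v → lexLeq (a ∷ u) (a ∷ v) ≡ lexLeq u v
lexLeq-∷ end         u v = refl
lexLeq-∷ (bit false) u v = refl
lexLeq-∷ (bit true)  u v = refl

≤ˡ-refl : ∀ x → x ≤ˡ x
≤ˡ-refl []      = refl
≤ˡ-refl (a ∷ x) = trans (lexLeq-∷ a x x) (≤ˡ-refl x)

≤ˡ-trans : ∀ x y z → x ≤ˡ y → y ≤ˡ z → x ≤ˡ z
≤ˡ-trans []      y       z       _ _ = refl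
≤ˡ-trans (a ∷ x) (b ∷ y) (c ∷ z) h g with lexLeq-∷⁻ a b x y h | lexLeq-∷⁻ b c y z g
... | inj₁ p          | inj₁ q          = lexLeq-rank< a c x z (<-trans p q)
... | inj₁ p          | inj₂ (refl , _) = lexLeq-rank< a b x z p
... | inj₂ (refl , _) | inj₁ q          = lexLeq-rank< a c x z q
... | inj₂ (refl , p) | inj₂ (refl , q) = trans (lexLeq-∷ a x z) (≤ˡ-trans x y z p q)

≤ˡ-total : ∀ x y → x <ˡ y → x ≤ˡ y
≤ˡ-total []      y       _ = refl
≤ˡ-total (a ∷ x) []      ()
≤ˡ-total (a ∷ x) (b ∷ y) h with <-cmp (rank a) (rank b)
... | tri< p _ _ = lexLeq-rank< a b x y p
... | tri> _ _ p = contradiction (trans (sym h) (lexLeq-rank< b a y x p)) λ ()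
... | tri≈ _ p _ with rank-injective a b p
... | refl = trans (lexLeq-∷ a x y) (≤ˡ-total x y (trans (sym (lexLeq-∷ a y x)) h))

≤ˡ-take : ∀ j x y → x ≤ˡ y → take j x ≤ˡ take j y
≤ˡ-take zero    x       y       _ = refl
≤ˡ-take (suc j) []      y       _ = refl
≤ˡ-take (suc j) (a ∷ x) (b ∷ y) h with lexLeq-∷⁻ a b x y h
... | inj₁ p          = lexLeq-rank< a b (take j x) (take j y) p
... | inj₂ (refl , p) = trans (lexLeq-∷ a (take j x) (take j y)) (≤ˡ-take j x y p)

<ˡ-∷ : ∀ c {xs} → AllPairs _<ˡ_ xs → AllPairs _<ˡ_ (map (c ∷_) xs)
<ˡ-∷ c = AllPairs.map⁺ ∘ AllPairs.map (λ {x} {y} x<y → trans (lexLeq-∷ c y x) x<y)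

∈-insert⁻ : ∀ {z} x ys → z ∈ insert x ys → z ≡ x ⊎ z ∈ ys
∈-insert⁻ x []       (here p) = inj₁ p
∈-insert⁻ x (y ∷ ys) h with lexLeq x y
∈-insert⁻ x (y ∷ ys) (here p)  | true  = inj₁ p
∈-insert⁻ x (y ∷ ys) (there h) | true  = inj₂ h
∈-insert⁻ x (y ∷ ys) (here p)  | false = inj₂ (here p)
∈-insert⁻ x (y ∷ ys) (there h) | false with ∈-insert⁻ x ys h
... | inj₁ p = inj₁ p
... | inj₂ q = inj₂ (there q)

∈-insert⁺ˡ : ∀ x ys → x ∈ insert x ys
∈-insert⁺ˡ x []       = here refl
∈-insert⁺ˡ x (y ∷ ys) with lexLeq x y
... | true  = here refl
... | false = there (∈-insert⁺ˡ x ys)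

∈-insert⁺ʳ : ∀ {z} x ys → z ∈ ys → z ∈ insert x ys
∈-insert⁺ʳ x (y ∷ ys) h with lexLeq x y
∈-insert⁺ʳ x (y ∷ ys) h         | true  = there h
∈-insert⁺ʳ x (y ∷ ys) (here p)  | false = here p
∈-insert⁺ʳ x (y ∷ ys) (there h) | false = there (∈-insert⁺ʳ x ys h)

∈-isort⁻ : ∀ {z} xs → z ∈ isort xs → z ∈ xs
∈-isort⁻ (x ∷ xs) h with ∈-insert⁻ x (isort xs) h
... | inj₁ p = here p
... | inj₂ q = there (∈-isort⁻ xs q)

∈-isort⁺ : ∀ {z} xs → z ∈ xs → z ∈ isort xs
∈-isort⁺ (x ∷ xs) (here refl) = ∈-insert⁺ˡ x (isort xs)
∈-isort⁺ (x ∷ xs) (there h)   = ∈-insert⁺ʳ x (isort xs) (∈-isort⁺ xs h)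

insert-sorted : ∀ x ys → AllPairs _≤ˡ_ ys → AllPairs _≤ˡ_ (insert x ys)
insert-sorted x []       _ = [] ∷ []
insert-sorted x (y ∷ ys) (y≤ys ∷ ys↗) with lexLeq x y in x≤y
... | true  = (x≤y ∷ All.map (≤ˡ-trans x y _ x≤y) y≤ys) ∷ y≤ys ∷ ys↗
... | false = All.tabulate y≤ ∷ insert-sorted x ys ys↗
  where
  y≤ : ∀ {z} → z ∈ insert x ys → y ≤ˡ z
  y≤ z∈ with ∈-insert⁻ x ys z∈
  ... | inj₁ refl = ≤ˡ-total y x x≤y
  ... | inj₂ q    = All.lookup y≤ys q

isort-sorted : ∀ xs → AllPairs _≤ˡ_ (isort xs)
isort-sorted []       = []
isort-sorted (x ∷ xs) = insert-sorted x (isort xs) (isort-sorted xs)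

module _ {B : Set} (f : List Sym → B) where

  insert-unique-map : ∀ x ys → (∀ {y} → y ∈ ys → f x ≢ f y) →
                      Unique (map f ys) → Unique (map f (insert x ys))
  insert-unique-map x []       _ _ = [] ∷ []
  insert-unique-map x (y ∷ ys) fresh (fy∉ ∷ u) with lexLeq x y
  ... | true  = All.tabulate fx≢ ∷ fy∉ ∷ u
    where
    fx≢ : ∀ {b} → b ∈ map f (y ∷ ys) → f x ≢ b
    fx≢ b∈ with ∈-map⁻ f b∈
    ... | c , c∈ , refl = fresh c∈
  ... | false = All.tabulate fy≢ ∷ insert-unique-map x ys (fresh ∘ there) u
    where
    fy≢ : ∀ {b} → b ∈ map f (insert x ys) → f y ≢ b
    fy≢ b∈ with ∈-map⁻ f b∈
    ... | c , c∈ , refl with ∈-insert⁻ x ys c∈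
    ... | inj₁ refl = fresh (here refl) ∘ sym
    ... | inj₂ q    = All.lookup fy∉ (∈-map⁺ f q)

  isort-unique-map : ∀ xs → Unique (map f xs) → Unique (map f (isort xs))
  isort-unique-map []       u          = []
  isort-unique-map (x ∷ xs) (fx∉ ∷ u) =
    insert-unique-map x (isort xs) (λ y∈ → All.lookup fx∉ (∈-map⁺ f (∈-isort⁻ xs y∈)))
                      (isort-unique-map xs u)

_≟ˢ_ : DecidableEquality Sym
end       ≟ˢ end       = yes refl
end       ≟ˢ bit _     = no λ ()
bit _     ≟ˢ end       = no λ ()
bit false ≟ˢ bit false = yes refl
bit true  ≟ˢ bit true  = yes refl
bit false ≟ˢ bit true  = no λ ()
bit true  ≟ˢ bit false = no λ ()

sorted-unique : ∀ xs ys → AllPairs _≤ˡ_ xs → Unique xs → AllPairs _<ˡ_ ys →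
                (∀ {x} → x ∈ xs → x ∈ ys) → (∀ {x} → x ∈ ys → x ∈ xs) → xs ≡ ys
sorted-unique []       []       _ _ _ _ _ = refl
sorted-unique []       (y ∷ ys) _ _ _ _ g with g (here refl)
... | ()
sorted-unique (x ∷ xs) []       _ _ _ f _ with f (here refl)
... | ()
sorted-unique (x ∷ xs) (y ∷ ys) (x≤ ∷ xs↗) (x∉ ∷ u) (y< ∷ ys↗) f g with List.≡-dec _≟ˢ_ x y
... | yes refl = cong (x ∷_) (sorted-unique xs ys xs↗ u ys↗ f′ g′)
  where
  f′ : ∀ {z} → z ∈ xs → z ∈ ys
  f′ z∈ with f (there z∈)
  ... | here refl = ⊥-elim (All.lookup x∉ z∈ refl)
  ... | there q   = q
  g′ : ∀ {z} → z ∈ ys → z ∈ xs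
  g′ z∈ with g (there z∈)
  ... | here refl = ⊥-elim (true≢false (trans (sym (≤ˡ-refl x)) (All.lookup y< z∈)))
  ... | there q   = q
... | no x≢y = ⊥-elim (true≢false (trans (sym (All.lookup x≤ y∈xs)) (All.lookup y< x∈ys)))
  where
  x∈ys : x ∈ ys
  x∈ys with f (here refl)
  ... | here p  = ⊥-elim (x≢y p)
  ... | there q = q
  y∈xs : y ∈ xs
  y∈xs with g (here refl)
  ... | here p  = ⊥-elim (x≢y (sym p))
  ... | there q = q

-- Polynomials over F₂ acting on binary sequences

≈ₚ-∷ : ∀ {p q} a → p ≈ₚ q → (a ∷ p) ≈ₚ (a ∷ q)
≈ₚ-∷ a h zero    = refl
≈ₚ-∷ a h (suc i) = h i

coeff-addP : ∀ p q i → coeff (addP p q) i ≡ coeff p i xor coeff q i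
coeff-addP []      q       i       = refl
coeff-addP (a ∷ p) []      i       = sym (xor-identityʳ _)
coeff-addP (a ∷ p) (b ∷ q) zero    = refl
coeff-addP (a ∷ p) (b ∷ q) (suc i) = coeff-addP p q i

addP-cong : ∀ {p p′ q q′} → p ≈ₚ p′ → q ≈ₚ q′ → addP p q ≈ₚ addP p′ q′
addP-cong {p} {p′} {q} {q′} p≈ q≈ i =
  trans (coeff-addP p q i) (trans (cong₂ _xor_ (p≈ i) (q≈ i)) (sym (coeff-addP p′ q′ i)))

addP-assoc : ∀ a b c → addP (addP a b) c ≈ₚ addP a (addP b c)
addP-assoc a b c i = begin
  coeff (addP (addP a b) c) i             ≡⟨ coeff-addP (addP a b) c i ⟩
  coeff (addP a b) i xor coeff c i        ≡⟨ cong (_xor coeff c i) (coeff-addP a b i) ⟩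
  (coeff a i xor coeff b i) xor coeff c i ≡⟨ xor-assoc (coeff a i) (coeff b i) (coeff c i) ⟩
  coeff a i xor (coeff b i xor coeff c i) ≡⟨ cong (coeff a i xor_) (sym (coeff-addP b c i)) ⟩
  coeff a i xor coeff (addP b c) i        ≡⟨ sym (coeff-addP a (addP b c) i) ⟩
  coeff (addP a (addP b c)) i ∎
  where open ≡-Reasoning

coeff-xpow : ∀ n i → coeff (xpow n) i ≡ (n ≡ᵇ i)
coeff-xpow zero    zero    = refl
coeff-xpow zero    (suc i) = refl
coeff-xpow (suc n) zero    = refl
coeff-xpow (suc n) (suc i) = coeff-xpow n i

coeff-mulP-∷ : ∀ a p q i → coeff (mulP (a ∷ p) q) i ≡ (a ∧ coeff q i) xor coeff (false ∷ mulP p q) i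
coeff-mulP-∷ true  p q i = coeff-addP q (false ∷ mulP p q) i
coeff-mulP-∷ false p q i = refl

mulP-zeroʳ : ∀ p → mulP p [] ≈ₚ []
mulP-zeroʳ []      i       = refl
mulP-zeroʳ (a ∷ p) zero    = trans (coeff-mulP-∷ a p [] 0) (cong (_xor false) (∧-zeroʳ a))
mulP-zeroʳ (a ∷ p) (suc i) = trans (coeff-mulP-∷ a p [] (suc i)) (cong₂ _xor_ (∧-zeroʳ a) (mulP-zeroʳ p i))

mulP-shiftʳ : ∀ p q → mulP p (false ∷ q) ≈ₚ (false ∷ mulP p q)
mulP-shiftʳ []      q zero    = refl
mulP-shiftʳ []      q (suc i) = refl
mulP-shiftʳ (a ∷ p) q zero    = trans (coeff-mulP-∷ a p (false ∷ q) 0) (cong (_xor false) (∧-zeroʳ a))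
mulP-shiftʳ (a ∷ p) q (suc i) = begin
  coeff (mulP (a ∷ p) (false ∷ q)) (suc i)
    ≡⟨ coeff-mulP-∷ a p (false ∷ q) (suc i) ⟩
  (a ∧ coeff q i) xor coeff (mulP p (false ∷ q)) i
    ≡⟨ cong ((a ∧ coeff q i) xor_) (mulP-shiftʳ p q i) ⟩
  (a ∧ coeff q i) xor coeff (false ∷ mulP p q) i
    ≡⟨ sym (coeff-mulP-∷ a p q i) ⟩
  coeff (mulP (a ∷ p) q) i ∎
  where open ≡-Reasoning

mulP-identityʳ : ∀ p → mulP p oneP ≈ₚ p
mulP-identityʳ []      i       = refl
mulP-identityʳ (c ∷ p) zero    =
  trans (coeff-mulP-∷ c p oneP 0) (trans (xor-identityʳ _) (∧-identityʳ c))
mulP-identityʳ (c ∷ p) (suc i) =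
  trans (coeff-mulP-∷ c p oneP (suc i)) (cong₂ _xor_ (∧-zeroʳ c) (mulP-identityʳ p i))

mulP-distribˡ-addP : ∀ p a b → mulP p (addP a b) ≈ₚ addP (mulP p a) (mulP p b)
mulP-distribˡ-addP []      a b i = refl
mulP-distribˡ-addP (c ∷ p) a b i = begin
  coeff (mulP (c ∷ p) (addP a b)) i
    ≡⟨ coeff-mulP-∷ c p (addP a b) i ⟩
  (c ∧ coeff (addP a b) i) xor coeff (false ∷ mulP p (addP a b)) i
    ≡⟨ cong₂ _xor_ (trans (cong (c ∧_) (coeff-addP a b i)) (∧-distribˡ-xor c _ _))
                   (trans (≈ₚ-∷ false (mulP-distribˡ-addP p a b) i)
                          (coeff-addP (false ∷ mulP p a) (false ∷ mulP p b) i)) ⟩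
  ((c ∧ coeff a i) xor (c ∧ coeff b i)) xor (coeff (false ∷ mulP p a) i xor coeff (false ∷ mulP p b) i)
    ≡⟨ xor-interchange (c ∧ coeff a i) (c ∧ coeff b i) (coeff (false ∷ mulP p a) i) (coeff (false ∷ mulP p b) i) ⟩
  ((c ∧ coeff a i) xor coeff (false ∷ mulP p a) i) xor ((c ∧ coeff b i) xor coeff (false ∷ mulP p b) i)
    ≡⟨ sym (cong₂ _xor_ (coeff-mulP-∷ c p a i) (coeff-mulP-∷ c p b i)) ⟩
  coeff (mulP (c ∷ p) a) i xor coeff (mulP (c ∷ p) b) i
    ≡⟨ sym (coeff-addP (mulP (c ∷ p) a) (mulP (c ∷ p) b) i) ⟩
  coeff (addP (mulP (c ∷ p) a) (mulP (c ∷ p) b)) i ∎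
  where open ≡-Reasoning

-- (act p σ) t = Σᵢ pᵢ σ(t + i), i.e. p evaluated at the shift operator.
act : Poly → (ℕ → Bool) → ℕ → Bool
act []      σ t = false
act (a ∷ p) σ t = (a ∧ σ t) xor act p σ (suc t)

act-cong : ∀ q {σ τ} → (∀ u → σ u ≡ τ u) → ∀ t → act q σ t ≡ act q τ t
act-cong []      h t = refl
act-cong (a ∷ q) h t = cong₂ (λ x y → (a ∧ x) xor y) (h t) (act-cong q h (suc t))

act-addP : ∀ p q σ t → act (addP p q) σ t ≡ act p σ t xor act q σ t
act-addP []      q       σ t = refl
act-addP (a ∷ p) []      σ t = sym (xor-identityʳ _)
act-addP (a ∷ p) (b ∷ q) σ t = begin
  ((a xor b) ∧ σ t) xor act (addP p q) σ (suc t)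
    ≡⟨ cong₂ _xor_ (∧-distribʳ-xor (σ t) a b) (act-addP p q σ (suc t)) ⟩
  ((a ∧ σ t) xor (b ∧ σ t)) xor (act p σ (suc t) xor act q σ (suc t))
    ≡⟨ xor-interchange (a ∧ σ t) (b ∧ σ t) (act p σ (suc t)) (act q σ (suc t)) ⟩
  ((a ∧ σ t) xor act p σ (suc t)) xor ((b ∧ σ t) xor act q σ (suc t)) ∎
  where open ≡-Reasoning

act-xor : ∀ q σ τ t → act q (λ u → σ u xor τ u) t ≡ act q σ t xor act q τ t
act-xor []      σ τ t = refl
act-xor (a ∷ q) σ τ t = begin
  (a ∧ (σ t xor τ t)) xor act q (λ u → σ u xor τ u) (suc t)
    ≡⟨ cong₂ _xor_ (∧-distribˡ-xor a (σ t) (τ t)) (act-xor q σ τ (suc t)) ⟩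
  ((a ∧ σ t) xor (a ∧ τ t)) xor (act q σ (suc t) xor act q τ (suc t))
    ≡⟨ xor-interchange (a ∧ σ t) (a ∧ τ t) (act q σ (suc t)) (act q τ (suc t)) ⟩
  ((a ∧ σ t) xor act q σ (suc t)) xor ((a ∧ τ t) xor act q τ (suc t)) ∎
  where open ≡-Reasoning

act-xpow : ∀ n σ t → act (xpow n) σ t ≡ σ (n + t)
act-xpow zero    σ t = xor-identityʳ _
act-xpow (suc n) σ t = trans (act-xpow n σ (suc t)) (cong σ (+-suc n t))

act-shift : ∀ n q σ t → act q σ (n + t) ≡ act q (λ u → σ (n + u)) t
act-shift n []      σ t = refl
act-shift n (a ∷ q) σ t = cong ((a ∧ σ (n + t)) xor_) (trans (cong (act q σ) (sym (+-suc n t))) (act-shift n q σ (suc t)))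

act-mulP : ∀ p q σ t → act (mulP p q) σ t ≡ act p (act q σ) t
act-mulP []      q σ t = refl
act-mulP (a ∷ p) q σ t =
  trans (act-addP (if a then q else []) (false ∷ mulP p q) σ t)
        (cong₂ _xor_ (act-if a) (act-mulP p q σ (suc t)))
  where
  act-if : ∀ a → act (if a then q else []) σ t ≡ a ∧ act q σ t
  act-if true  = refl
  act-if false = refl

act-zero : ∀ p σ t → (∀ i → coeff p i ≡ false) → act p σ t ≡ false
act-zero []      σ t h = refl
act-zero (a ∷ p) σ t h rewrite h 0 = act-zero p σ (suc t) (h ∘ suc)

act-≈ₚ : ∀ p q σ t → p ≈ₚ q → act p σ t ≡ act q σ t
act-≈ₚ []      []      σ t h = refl
act-≈ₚ []      (b ∷ q) σ t h = sym (act-zero (b ∷ q) σ t (sym ∘ h))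
act-≈ₚ (a ∷ p) []      σ t h = act-zero (a ∷ p) σ t h
act-≈ₚ (a ∷ p) (b ∷ q) σ t h rewrite h 0 = cong ((b ∧ σ t) xor_) (act-≈ₚ p q σ (suc t) (h ∘ suc))

DegreeBelow : ℕ → Poly → Set
DegreeBelow d r = ∀ j → d ≤ j → coeff r j ≡ false

module _ (τ : ℕ → Bool) (c : ℕ) (τ<c : ∀ t → t < c → τ t ≡ false) (τc : τ c ≡ true) where

  act-impulse : ∀ r t i → t + i ≡ c → DegreeBelow (suc i) r → act r τ t ≡ coeff r i
  act-impulse []      t i       _ _ = refl
  act-impulse (a ∷ r) t zero    e small rewrite act-zero r τ (suc t) (λ j → small (suc j) (s≤s z≤n))
                                              | +-identityʳ t | e | τc = trans (xor-identityʳ _) (∧-identityʳ a)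
  act-impulse (a ∷ r) t (suc i) e small rewrite τ<c t (subst (t <_) e (m<m+n t (s≤s z≤n))) | ∧-zeroʳ a =
    act-impulse r (suc t) i (trans (sym (+-suc t i)) e) (λ j p → small (suc j) (s≤s p))

  impulse-annihilator : ∀ r → DegreeBelow (suc c) r → (∀ t → act r τ t ≡ false) → r ≈ₚ []
  impulse-annihilator r small annihilates j = vanish (suc c) j (m≤n+m (suc c) j)
    where
    vanish : ∀ d j → suc c ≤ j + d → coeff r j ≡ false
    vanish zero    j p = small j (subst (suc c ≤_) (+-identityʳ j) p)
    vanish (suc d) j p with m≤n⇒m<n∨m≡n (≤-pred (subst (suc c ≤_) (+-suc j d) p))
    ... | inj₁ c<j+d = vanish d j c<j+d
    ... | inj₂ c≡j+d = trans (sym (act-impulse r d j (trans (+-comm d j) (sym c≡j+d)) above)) (annihilates d)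
      where
      above : DegreeBelow (suc j) r
      above j′ j<j′ = vanish d j′ (subst (_≤ j′ + d) (cong suc (sym c≡j+d)) (+-monoˡ-≤ d j<j′))

-- Feedback shift registers and the recurrence of Tₖ

iter-+ : ∀ j a (f : List Bool → List Bool) x → iter (j + a) f x ≡ iter j f (iter a f x)
iter-+ zero    a f x = refl
iter-+ (suc j) a f x = cong f (iter-+ j a f x)

iter-cong : ∀ {f g : List Bool → List Bool} → (∀ x → f x ≡ g x) → ∀ t x → iter t f x ≡ iter t g x
iter-cong f≗g zero    x = refl
iter-cong {f} f≗g (suc t) x = trans (cong f (iter-cong f≗g t x)) (f≗g _)

iter-cancel : ∀ {f : List Bool → List Bool} → (∀ x y → f x ≡ f y → x ≡ y) →
              ∀ a e x → iter a f x ≡ iter (a + e) f x → x ≡ iter e f x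
iter-cancel inj zero    e x h = h
iter-cancel inj (suc a) e x h = iter-cancel inj a e x (inj _ _ h)

fsr : (Bool → List Bool → Bool) → List Bool → List Bool
fsr f (x₀ ∷ x₁ ∷ r) = x₁ ∷ r ++ [ x₀ xor f x₁ r ]
fsr f xs            = xs

module _ (f : Bool → List Bool → Bool) where

  length-fsr : ∀ x → length (fsr f x) ≡ length x
  length-fsr []            = refl
  length-fsr (_ ∷ [])      = refl
  length-fsr (x₀ ∷ x₁ ∷ r) = cong suc (trans (List.length-++ r) (+-comm (length r) 1))

  nth-fsr : ∀ x j → suc j < length x → nth false (fsr f x) j ≡ nth false x (suc j)
  nth-fsr (_ ∷ [])      zero    (s≤s ())
  nth-fsr (x₀ ∷ x₁ ∷ r) zero    _             = refl
  nth-fsr (x₀ ∷ x₁ ∷ r) (suc j) (s≤s (s≤s p)) = nth-++ˡ false r _ j p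

  nth-fsr-last : ∀ x₀ x₁ r → nth false (fsr f (x₀ ∷ x₁ ∷ r)) (suc (length r)) ≡ x₀ xor f x₁ r
  nth-fsr-last x₀ x₁ r = trans (cong (nth false (r ++ _)) (sym (+-identityʳ (length r)))) (nth-++ʳ false r _ 0)

  fsr-injective : ∀ x x′ → fsr f x ≡ fsr f x′ → x ≡ x′
  fsr-injective []             []                 _ = refl
  fsr-injective []             (_ ∷ [])           ()
  fsr-injective []             (_ ∷ _ ∷ _)        ()
  fsr-injective (_ ∷ [])       []                 ()
  fsr-injective (_ ∷ _ ∷ _)    []                 ()
  fsr-injective (_ ∷ [])       (_ ∷ [])           h = h
  fsr-injective (x₀ ∷ x₁ ∷ r)  (x₀′ ∷ x₁′ ∷ r′)   h
    with refl , h′ ← List.∷-injective h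
    with refl , c≡ ← List.∷ʳ-injective r r′ h′ = cong (_∷ x₁ ∷ r) (xor-cancelʳ x₀ x₀′ (f x₁ r) c≡)
  fsr-injective (_ ∷ [])       (_ ∷ _ ∷ r)        h = ⊥-elim (∷ʳ≢[] r (sym (proj₂ (List.∷-injective h))))
  fsr-injective (_ ∷ _ ∷ r)    (_ ∷ [])           h = ⊥-elim (∷ʳ≢[] r (proj₂ (List.∷-injective h)))

  length-iter-fsr : ∀ t x → length (iter t (fsr f) x) ≡ length x
  length-iter-fsr zero    x = refl
  length-iter-fsr (suc t) x = trans (length-fsr (iter t (fsr f) x)) (length-iter-fsr t x)

  iter-fsr-window : ∀ x t j → j < length x →
                    nth false (iter t (fsr f) x) j ≡ headB (iter (t + j) (fsr f) x)
  iter-fsr-window x t zero    _ =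
    trans (sym (headB-nth (iter t (fsr f) x))) (cong (λ u → headB (iter u (fsr f) x)) (sym (+-identityʳ t)))
  iter-fsr-window x t (suc j) p = begin
    nth false (iter t (fsr f) x) (suc j)
      ≡⟨ sym (nth-fsr (iter t (fsr f) x) j (subst (suc j <_) (sym (length-iter-fsr t x)) p)) ⟩
    nth false (iter (suc t) (fsr f) x) j
      ≡⟨ iter-fsr-window x (suc t) j (<-trans (n<1+n j) p) ⟩
    headB (iter (suc t + j) (fsr f) x)
      ≡⟨ cong (λ u → headB (iter u (fsr f) x)) (sym (+-suc t j)) ⟩
    headB (iter (t + suc j) (fsr f) x) ∎
    where open ≡-Reasoning

module Recurrence (k : ℕ) where

  Recurrent : (ℕ → Bool) → Set
  Recurrent τ = ∀ t → τ (k + t) ≡ τ t xor τ (suc t)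

  recurrent-act : ∀ q {τ} → Recurrent τ → Recurrent (act q τ)
  recurrent-act q {τ} rec t = begin
    act q τ (k + t)                   ≡⟨ act-shift k q τ t ⟩
    act q (λ u → τ (k + u)) t         ≡⟨ act-cong q rec t ⟩
    act q (λ u → τ u xor τ (suc u)) t ≡⟨ act-xor q τ (τ ∘ suc) t ⟩
    act q τ t xor act q (τ ∘ suc) t   ≡⟨ cong (act q τ t xor_) (sym (act-shift 1 q τ t)) ⟩
    act q τ t xor act q τ (suc t) ∎
    where open ≡-Reasoning

  T-annihilates : ∀ {τ} → Recurrent τ → ∀ t → act (T k) τ t ≡ false
  T-annihilates {τ} rec t
    rewrite act-addP (addP (xpow k) (xpow 1)) oneP τ t | act-addP (xpow k) (xpow 1) τ t
          | act-xpow k τ t | act-xpow 1 τ t | act-xpow 0 τ t | rec t = cancel (τ t) (τ (suc t))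
    where
    cancel : ∀ a b → ((a xor b) xor b) xor a ≡ false
    cancel true  true  = refl
    cancel true  false = refl
    cancel false true  = refl
    cancel false false = refl

  T∣⇒periodic : ∀ {τ} e → Recurrent τ → T k ∣ₚ addP (xpow e) oneP → ∀ t → τ (e + t) ≡ τ t
  T∣⇒periodic {τ} e rec (h , x^e+1≈Th) t = xor≡false⇒≡ _ _ (begin
    τ (e + t) xor τ t                 ≡⟨ sym (cong₂ _xor_ (act-xpow e τ t) (act-xpow 0 τ t)) ⟩
    act (xpow e) τ t xor act oneP τ t ≡⟨ sym (act-addP (xpow e) oneP τ t) ⟩
    act (addP (xpow e) oneP) τ t      ≡⟨ act-≈ₚ (addP (xpow e) oneP) (mulP (T k) h) τ t x^e+1≈Th ⟩
    act (mulP (T k) h) τ t            ≡⟨ act-mulP (T k) h τ t ⟩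
    act (T k) (act h τ) t             ≡⟨ T-annihilates (recurrent-act h rec) t ⟩
    false ∎)
    where open ≡-Reasoning

-- The register of Tₖ, primitivity, and the de Bruijn register F'

lfsrStep : List Bool → List Bool
lfsrStep = fsr (λ x₁ _ → x₁)

deBruijnFeedback : Bool → List Bool → Bool
deBruijnFeedback x₁ r = x₁ xor (if allZero (x₁ ∷ r) then true else false)

F'≡fsr : ∀ x → F' x ≡ fsr deBruijnFeedback x
F'≡fsr []            = refl
F'≡fsr (_ ∷ [])      = refl
F'≡fsr (x₀ ∷ x₁ ∷ r) = cong (λ c → x₁ ∷ r ++ [ c ]) (xor-assoc x₀ x₁ _)

F'-injective : ∀ x x′ → F' x ≡ F' x′ → x ≡ x′
F'-injective x x′ h = fsr-injective deBruijnFeedback x x′ (trans (sym (F'≡fsr x)) (trans h (F'≡fsr x′)))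

module LFSR (m : ℕ) where

  k : ℕ
  k = suc (suc m)

  open Recurrence k public

  initialState : List Bool
  initialState = replicate (suc m) false ++ [ true ]

  state : ℕ → List Bool
  state t = iter t lfsrStep initialState

  σ : ℕ → Bool
  σ t = headB (state t)

  length-initialState : length initialState ≡ k
  length-initialState =
    trans (List.length-++ (replicate (suc m) false)) (trans (cong (_+ 1) (List.length-replicate (suc m))) (+-comm (suc m) 1))

  length-state : ∀ t → length (state t) ≡ k
  length-state t = trans (length-iter-fsr _ t initialState) length-initialState

  state-window : ∀ t j → j < k → nth false (state t) j ≡ σ (t + j)
  state-window t j p = iter-fsr-window _ initialState t j (subst (j <_) (sym length-initialState) p)

  nth-lfsrStep-last : ∀ x → length x ≡ k → nth false (lfsrStep x) (suc m) ≡ nth false x 0 xor nth false x 1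
  nth-lfsrStep-last (x₀ ∷ x₁ ∷ r) e rewrite sym (suc-injective (suc-injective e)) = nth-fsr-last (λ x₁ _ → x₁) x₀ x₁ r

  σ-recurrent : Recurrent σ
  σ-recurrent t = begin
    σ (k + t)
      ≡⟨ cong σ (cong suc (+-comm (suc m) t)) ⟩
    σ (suc t + suc m)
      ≡⟨ sym (state-window (suc t) (suc m) ≤-refl) ⟩
    nth false (lfsrStep (state t)) (suc m)
      ≡⟨ nth-lfsrStep-last (state t) (length-state t) ⟩
    nth false (state t) 0 xor nth false (state t) 1
      ≡⟨ cong₂ _xor_ (state-window t 0 (s≤s z≤n)) (state-window t 1 (s≤s (s≤s z≤n))) ⟩
    σ (t + 0) xor σ (t + 1)
      ≡⟨ cong₂ _xor_ (cong σ (+-identityʳ t)) (cong σ (+-comm t 1)) ⟩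
    σ t xor σ (suc t) ∎
    where open ≡-Reasoning

  σ-initial : ∀ t → t < suc m → σ t ≡ false
  σ-initial t p = begin
    σ t
      ≡⟨ sym (state-window 0 t (<-trans p (n<1+n (suc m)))) ⟩
    nth false initialState t
      ≡⟨ nth-++ˡ false (replicate (suc m) false) _ t (subst (t <_) (sym (List.length-replicate (suc m))) p) ⟩
    nth false (replicate (suc m) false) t
      ≡⟨ nth-replicate false false (suc m) t p ⟩
    false ∎
    where open ≡-Reasoning

  σ-impulse : σ (suc m) ≡ true
  σ-impulse = begin
    σ (suc m)
      ≡⟨ sym (state-window 0 (suc m) ≤-refl) ⟩
    nth false initialState (suc m)
      ≡⟨ cong (nth false initialState) (sym (trans (+-identityʳ _) (List.length-replicate (suc m)))) ⟩
    nth false initialState (length (replicate (suc m) false) + 0)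
      ≡⟨ nth-++ʳ false (replicate (suc m) false) [ true ] 0 ⟩
    true ∎
    where open ≡-Reasoning

  state-nonzero : ∀ t → state t ≢ replicate k false
  state-nonzero zero    h =
    true≢false (proj₂ (List.∷ʳ-injective (replicate (suc m) false) (replicate (suc m) false)
                                         (trans h (sym (replicate-∷ʳ (suc m) false)))))
  state-nonzero (suc t) h = state-nonzero t (fsr-injective _ (state t) (replicate k false) (trans h (sym lfsrStep-zero)))
    where
    lfsrStep-zero : lfsrStep (replicate k false) ≡ replicate k false
    lfsrStep-zero = cong (false ∷_) (replicate-∷ʳ m false)

  state-return⇒periodic : ∀ e → initialState ≡ state e → ∀ t → σ (e + t) ≡ σ t
  state-return⇒periodic e h t = begin
    σ (e + t)
      ≡⟨ cong (headB ∘ λ u → iter u lfsrStep initialState) (+-comm e t) ⟩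
    headB (iter (t + e) lfsrStep initialState)
      ≡⟨ cong headB (iter-+ t e lfsrStep initialState) ⟩
    headB (iter t lfsrStep (state e))
      ≡⟨ cong (headB ∘ iter t lfsrStep) (sym h) ⟩
    σ t ∎
    where open ≡-Reasoning

  coeff-T-high : ∀ j → k ≤ j → coeff (T k) j ≡ (k ≡ᵇ j)
  coeff-T-high (suc (suc j)) (s≤s (s≤s _))
    rewrite coeff-addP (addP (xpow k) (xpow 1)) oneP (suc (suc j)) | coeff-addP (xpow k) (xpow 1) (suc (suc j))
          | coeff-xpow k (suc (suc j)) = trans (xor-identityʳ _) (xor-identityʳ _)

  DivisionOf : ℕ → Poly × Poly → Set
  DivisionOf e (r , q) = DegreeBelow k r × addP (xpow e) r ≈ₚ mulP (T k) q

  -- Long division of xᵉ by Tₖ, one power of x at a time: returns (xᵉ mod Tₖ , xᵉ div Tₖ).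
  reduceStep : Poly × Poly → Poly × Poly
  reduceStep (r , q) = if coeff r (suc m) then (addP (false ∷ r) (T k) , addP (false ∷ q) oneP)
                                           else (false ∷ r , false ∷ q)

  xpowModT : ℕ → Poly × Poly
  xpowModT zero    = oneP , []
  xpowModT (suc e) = reduceStep (xpowModT e)

  reduceStep-correct : ∀ e r q → DivisionOf e (r , q) → DivisionOf (suc e) (reduceStep (r , q))
  reduceStep-correct e r q (small , x^e+r≈Tq) with coeff r (suc m) in carry
  ... | false = small′ , λ i → trans (≈ₚ-∷ false x^e+r≈Tq i) (sym (mulP-shiftʳ (T k) q i))
    where
    small′ : DegreeBelow k (false ∷ r)
    small′ (suc j) (s≤s p) with m≤n⇒m<n∨m≡n p
    ... | inj₁ k≤j = small j k≤j
    ... | inj₂ refl = carry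
  ... | true = small′ , λ i → begin
    coeff (addP (xpow (suc e)) (addP (false ∷ r) (T k))) i
      ≡⟨ sym (addP-assoc (xpow (suc e)) (false ∷ r) (T k) i) ⟩
    coeff (addP (false ∷ addP (xpow e) r) (T k)) i
      ≡⟨ addP-cong {false ∷ addP (xpow e) r} {false ∷ mulP (T k) q} {T k} {T k}
                   (≈ₚ-∷ false x^e+r≈Tq) (λ _ → refl) i ⟩
    coeff (addP (false ∷ mulP (T k) q) (T k)) i
      ≡⟨ addP-cong {false ∷ mulP (T k) q} {mulP (T k) (false ∷ q)} {T k} {mulP (T k) oneP}
                   (λ i → sym (mulP-shiftʳ (T k) q i)) (λ i → sym (mulP-identityʳ (T k) i)) i ⟩
    coeff (addP (mulP (T k) (false ∷ q)) (mulP (T k) oneP)) i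
      ≡⟨ sym (mulP-distribˡ-addP (T k) (false ∷ q) oneP i) ⟩
    coeff (mulP (T k) (addP (false ∷ q) oneP)) i ∎
    where
    open ≡-Reasoning
    small′ : DegreeBelow k (addP (false ∷ r) (T k))
    small′ j p rewrite coeff-addP (false ∷ r) (T k) j | coeff-T-high j p with m≤n⇒m<n∨m≡n p
    ... | inj₂ refl rewrite ≡ᵇ-refl k = cong (_xor true) carry
    small′ (suc j) p | inj₁ (s≤s k≤j) rewrite <⇒≡ᵇ-false k (suc j) (s≤s k≤j) | small j k≤j = refl

  xpowModT-correct : ∀ e → DivisionOf e (xpowModT e)
  xpowModT-correct zero    = (λ { (suc j) _ → refl }) , λ i →
    trans (trans (coeff-addP oneP oneP i) (xor-same (coeff oneP i))) (sym (mulP-zeroʳ (T k) i))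
  xpowModT-correct (suc e) = reduceStep-correct e _ _ (xpowModT-correct e)

  -- With xᵉ ≡ r (mod Tₖ), e-periodicity of σ makes r + 1 annihilate σ, so r = 1 by the impulse lemma.
  periodic⇒T∣ : ∀ e → (∀ t → σ (e + t) ≡ σ t) → T k ∣ₚ addP (xpow e) oneP
  periodic⇒T∣ e periodic = q , λ i → begin
    coeff (addP (xpow e) oneP) i
      ≡⟨ addP-cong {xpow e} {xpow e} {oneP} {r} (λ _ → refl) (λ i → sym (r≈1 i)) i ⟩
    coeff (addP (xpow e) r) i
      ≡⟨ x^e+r≈Tq i ⟩
    coeff (mulP (T k) q) i ∎
    where
    open ≡-Reasoning
    r = proj₁ (xpowModT e)
    q = proj₂ (xpowModT e)
    small = proj₁ (xpowModT-correct e)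
    x^e+r≈Tq = proj₂ (xpowModT-correct e)
    act-r : ∀ t → act r σ t ≡ σ t
    act-r t = trans (sym (xor≡false⇒≡ _ _ (begin
      σ (e + t) xor act r σ t
        ≡⟨ cong (_xor act r σ t) (sym (act-xpow e σ t)) ⟩
      act (xpow e) σ t xor act r σ t
        ≡⟨ sym (act-addP (xpow e) r σ t) ⟩
      act (addP (xpow e) r) σ t
        ≡⟨ act-≈ₚ (addP (xpow e) r) (mulP (T k) q) σ t x^e+r≈Tq ⟩
      act (mulP (T k) q) σ t
        ≡⟨ act-mulP (T k) q σ t ⟩
      act (T k) (act q σ) t
        ≡⟨ T-annihilates {act q σ} (recurrent-act q {σ} σ-recurrent) t ⟩
      false ∎))) (periodic t)
    r+1≈0 : addP r oneP ≈ₚ []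
    r+1≈0 = impulse-annihilator σ (suc m) σ-initial σ-impulse (addP r oneP) small′ annihilates
      where
      small′ : DegreeBelow k (addP r oneP)
      small′ (suc j) p rewrite coeff-addP r oneP (suc j) | small (suc j) p = refl
      annihilates : ∀ t → act (addP r oneP) σ t ≡ false
      annihilates t rewrite act-addP r oneP σ t | act-xpow 0 σ t | act-r t = xor-same (σ t)
    r≈1 : r ≈ₚ oneP
    r≈1 i = xor≡false⇒≡ _ _ (trans (sym (coeff-addP r oneP i)) (r+1≈0 i))

module Primitivity (m : ℕ) (prim : Primitive (suc (suc m)) (T (suc (suc m)))) where

  open LFSR m public

  n N′ N : ℕ
  n  = 2 ^ k
  N′ = 2 ^ k ∸ 2
  N  = suc N′

  n≡suc-N : n ≡ suc N
  n≡suc-N = trans (sym (m∸n+n≡m 2≤2^k)) (+-comm N′ 2)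
    where
    2≤2^k : 2 ≤ 2 ^ k
    2≤2^k = *-monoʳ-≤ 2 (m^n>0 2 (suc m))

  σ-periodic : ∀ t → σ (N + t) ≡ σ t
  σ-periodic = T∣⇒periodic N σ-recurrent
    (subst (λ e → T k ∣ₚ addP (xpow e) oneP) (cong (_∸ 1) n≡suc-N) (proj₁ (proj₂ prim)))

  state-injective : ∀ a b → a < b → b < N → state a ≢ state b
  state-injective a b a<b b<N h = proj₂ (proj₂ prim) e (m<n⇒0<n∸m a<b) e<2^k-1 (periodic⇒T∣ e σ-e-periodic)
    where
    e = b ∸ a
    e<2^k-1 : e < 2 ^ k ∸ 1
    e<2^k-1 = subst (e <_) (sym (cong (_∸ 1) n≡suc-N)) (≤-<-trans (m∸n≤m b a) b<N)
    σ-e-periodic : ∀ t → σ (e + t) ≡ σ t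
    σ-e-periodic = state-return⇒periodic e
      (iter-cancel (fsr-injective _) a e initialState (trans h (cong state (sym (m+[n∸m]≡n (<⇒≤ a<b))))))

  state-last : state N′ ≡ true ∷ replicate (suc m) false
  state-last = nth-ext false _ _ (trans (length-state N′) (cong (suc ∘ suc) (sym (List.length-replicate m)))) entry
    where
    σN′ : σ N′ ≡ true
    σN′ = xor-cancelʳ (σ N′) true false (begin
      σ N′ xor false
        ≡⟨ cong (σ N′ xor_) (sym (trans (σ-periodic 0) (σ-initial 0 (s≤s z≤n)))) ⟩
      σ N′ xor σ (N + 0)
        ≡⟨ cong (λ t → σ N′ xor σ t) (+-identityʳ N) ⟩
      σ N′ xor σ (suc N′)
        ≡⟨ sym (σ-recurrent N′) ⟩
      σ (k + N′)
        ≡⟨ cong σ (cong suc (+-comm (suc m) N′)) ⟩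
      σ (N + suc m)
        ≡⟨ σ-periodic (suc m) ⟩
      σ (suc m)
        ≡⟨ σ-impulse ⟩
      true ∎)
      where open ≡-Reasoning
    entry : ∀ j → j < length (state N′) → nth false (state N′) j ≡ nth false (true ∷ replicate (suc m) false) j
    entry zero    _ = trans (state-window N′ 0 (s≤s z≤n)) (trans (cong σ (+-identityʳ N′)) σN′)
    entry (suc j) p = begin
      nth false (state N′) (suc j) ≡⟨ state-window N′ (suc j) j<k ⟩
      σ (N′ + suc j)               ≡⟨ cong σ (+-suc N′ j) ⟩
      σ (N + j)                    ≡⟨ σ-periodic j ⟩
      σ j                          ≡⟨ σ-initial j (≤-pred j<k) ⟩
      false                        ≡⟨ sym (nth-replicate false false (suc m) j (≤-pred j<k)) ⟩
      nth false (replicate (suc m) false) j ∎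
      where
      open ≡-Reasoning
      j<k : suc j < k
      j<k = subst (suc j <_) (length-state N′) p

  y : ℕ → List Bool
  y t = iter t F' (replicate k false)

  F'-state : ∀ t → t < N′ → F' (state t) ≡ lfsrStep (state t)
  F'-state t t<N′ with state t in eq | length-state t
  ... | x₀ ∷ x₁ ∷ r | len with allZero (x₁ ∷ r) in tail-zero
  ... | false = cong (λ c → x₁ ∷ r ++ [ c ]) (xor-identityʳ (x₀ xor x₁))
  ... | true = ⊥-elim (excluded x₀ (trans eq (cong (x₀ ∷_) tail≡0)))
    where
    tail≡0 : x₁ ∷ r ≡ replicate (suc m) false
    tail≡0 = trans (allZero⇒replicate (x₁ ∷ r) tail-zero) (cong (λ l → replicate l false) (suc-injective len))
    excluded : ∀ x₀ → state t ≢ x₀ ∷ replicate (suc m) false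
    excluded false h = state-nonzero t h
    excluded true  h = state-injective t N′ t<N′ ≤-refl (trans h (sym state-last))

  y-suc : ∀ t → t < N → y (suc t) ≡ state t
  y-suc zero    _   rewrite allZero-replicate m = refl
  y-suc (suc t) t<N = trans (cong F' (y-suc t (<-trans (n<1+n t) t<N))) (F'-state t (≤-pred t<N))

  y-period : y n ≡ y 0
  y-period = begin
    y n
      ≡⟨ cong y n≡suc-N ⟩
    F' (y N)
      ≡⟨ cong F' (y-suc N′ ≤-refl) ⟩
    F' (state N′)
      ≡⟨ cong F' state-last ⟩
    F' (true ∷ replicate (suc m) false)
      ≡⟨ cong (λ z → false ∷ replicate m false ++ [ not (if z then true else false) ]) (allZero-replicate m) ⟩
    false ∷ replicate m false ++ [ false ]
      ≡⟨ cong (false ∷_) (replicate-∷ʳ m false) ⟩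
    y 0 ∎
    where open ≡-Reasoning

  y-shift-period : ∀ t → y (t + n) ≡ y t
  y-shift-period t = trans (iter-+ t n F' _) (cong (iter t F') y-period)

  y-nonreturning : ∀ e → 0 < e → e < n → y e ≢ y 0
  y-nonreturning (suc e) _ e<n ye≡y0 =
    state-nonzero e (trans (sym (y-suc e (≤-pred (subst (suc e <_) n≡suc-N e<n)))) ye≡y0)

  y-injective : ∀ a b → a < b → b < a + n → y a ≢ y b
  y-injective a b a<b b<a+n h = y-nonreturning (b ∸ a) (m<n⇒0<n∸m a<b) b∸a<n
    (sym (iter-cancel F'-injective a (b ∸ a) _ (trans h (cong y (sym a+[b∸a]≡b)))))
    where
    a+[b∸a]≡b = m+[n∸m]≡n (<⇒≤ a<b)
    b∸a<n : b ∸ a < n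
    b∸a<n = +-cancelˡ-< a (b ∸ a) n (subst (_< a + n) (sym a+[b∸a]≡b) b<a+n)

-- Length-k prefixes and the letter preceding them

toBits : List Sym → List Bool
toBits []          = []
toBits (end ∷ r)   = false ∷ toBits r
toBits (bit b ∷ r) = b ∷ toBits r

toBits-map-bit : ∀ v → toBits (map bit v) ≡ v
toBits-map-bit []      = refl
toBits-map-bit (b ∷ v) = cong (b ∷_) (toBits-map-bit v)

containsEnd : List Sym → Bool
containsEnd []          = false
containsEnd (end ∷ r)   = true
containsEnd (bit _ ∷ r) = containsEnd r

containsEnd-map-bit : ∀ v → containsEnd (map bit v) ≡ false
containsEnd-map-bit []      = refl
containsEnd-map-bit (b ∷ v) = containsEnd-map-bit v

endPosition : List Sym → ℕ
endPosition []          = 0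
endPosition (end ∷ r)   = 0
endPosition (bit _ ∷ r) = suc (endPosition r)

map-bit-injective : ∀ {v v′} → map bit v ≡ map bit v′ → v ≡ v′
map-bit-injective {[]}    {[]}      _ = refl
map-bit-injective {a ∷ v} {a′ ∷ v′} e with refl , e′ ← List.∷-injective e = cong (a ∷_) (map-bit-injective e′)

allWords : ℕ → List (List Bool)
allWords zero    = [ [] ]
allWords (suc j) = map (false ∷_) (allWords j) ++ map (true ∷_) (allWords j)

length-∈-allWords : ∀ j {v} → v ∈ allWords j → length v ≡ j
length-∈-allWords zero    (here refl) = refl
length-∈-allWords (suc j) v∈ with ∈-++⁻ (map (false ∷_) (allWords j)) v∈
... | inj₁ p with _ , w∈ , refl ← ∈-map⁻ (false ∷_) p = cong suc (length-∈-allWords j w∈)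
... | inj₂ p with _ , w∈ , refl ← ∈-map⁻ (true ∷_) p  = cong suc (length-∈-allWords j w∈)

∈-allWords : ∀ v → v ∈ allWords (length v)
∈-allWords []          = here refl
∈-allWords (false ∷ v) = ∈-++⁺ˡ (∈-map⁺ (false ∷_) (∈-allWords v))
∈-allWords (true ∷ v)  = ∈-++⁺ʳ (map (false ∷_) (allWords (length v))) (∈-map⁺ (true ∷_) (∈-allWords v))

length-allWords : ∀ j → length (allWords j) ≡ 2 ^ j
length-allWords zero    = refl
length-allWords (suc j) = begin
  length (map (false ∷_) (allWords j) ++ map (true ∷_) (allWords j))
    ≡⟨ List.length-++ (map (false ∷_) (allWords j)) ⟩
  length (map (false ∷_) (allWords j)) + length (map (true ∷_) (allWords j))
    ≡⟨ cong₂ _+_ (List.length-map _ (allWords j)) (List.length-map _ (allWords j)) ⟩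
  length (allWords j) + length (allWords j)
    ≡⟨ cong₂ _+_ (length-allWords j) (length-allWords j) ⟩
  2 ^ j + 2 ^ j
    ≡⟨ cong (2 ^ j +_) (sym (+-identityʳ (2 ^ j))) ⟩
  2 ^ suc j ∎
  where open ≡-Reasoning

words : ℕ → List (List Sym)
words j = map (map bit) (allWords j)

words-suc : ∀ j → words (suc j) ≡ map (bit false ∷_) (words j) ++ map (bit true ∷_) (words j)
words-suc j = trans (List.map-++ (map bit) (map (false ∷_) (allWords j)) _)
                    (cong₂ _++_ (trans (sym (List.map-∘ (allWords j))) (List.map-∘ (allWords j)))
                                (trans (sym (List.map-∘ (allWords j))) (List.map-∘ (allWords j))))

words-sorted : ∀ j → AllPairs _<ˡ_ (words j)
words-sorted zero    = [] ∷ []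
words-sorted (suc j) rewrite words-suc j =
  AllPairs.++⁺ (<ˡ-∷ (bit false) (words-sorted j)) (<ˡ-∷ (bit true) (words-sorted j))
               (All.tabulate λ x∈ → All.tabulate λ y∈ → 0w<1w x∈ y∈)
  where
  0w<1w : ∀ {x y} → x ∈ map (bit false ∷_) (words j) → y ∈ map (bit true ∷_) (words j) → x <ˡ y
  0w<1w x∈ y∈ with _ , _ , refl ← ∈-map⁻ (bit false ∷_) x∈ | _ , _ , refl ← ∈-map⁻ (bit true ∷_) y∈ = refl

-- With flags z and o recording whether the bits dropped so far were all 0 resp. all 1,
-- this is the letter preceding the window in the cyclic word M.
letterBefore′ : Bool → Bool → List Bool → Sym
letterBefore′ z o []              = end
letterBefore′ z o (a ∷ [])        = end
letterBefore′ z o (a ∷ b ∷ [])    = if z ∧ not a ∧ not b then end else bit (not (a xor b) xor (o ∧ a))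
letterBefore′ z o (a ∷ b ∷ c ∷ r) = letterBefore′ (z ∧ not a) (o ∧ a) (b ∷ c ∷ r)

repeatWord : List Sym → ℕ → List Sym
repeatWord w c = concat (replicate c w)

repeatWord-+ : ∀ w a b → repeatWord w (a + b) ≡ repeatWord w a ++ repeatWord w b
repeatWord-+ w zero    b = refl
repeatWord-+ w (suc a) b = trans (cong (w ++_) (repeatWord-+ w a b)) (sym (List.++-assoc w (repeatWord w a) (repeatWord w b)))

w1001 w0011 w1010 w010 : List Sym
w1001 = bit true  ∷ bit false ∷ bit false ∷ bit true  ∷ []
w0011 = bit false ∷ bit false ∷ bit true  ∷ bit true  ∷ []
w1010 = bit true  ∷ bit false ∷ bit true  ∷ bit false ∷ []
w010  = bit false ∷ bit true  ∷ bit false ∷ []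

letterBlock : Bool → Bool → ℕ → List Sym
letterBlock false false x = repeatWord w1001 x
letterBlock true  false x = end ∷ bit false ∷ bit false ∷ bit true ∷ repeatWord w1001 (x ∸ 1)
letterBlock false true  x = repeatWord w1001 (x ∸ 1) ++ w1010
letterBlock true  true  x = end ∷ repeatWord w0011 (x ∸ 1) ++ w010

letterBlock-double : ∀ z o a → letterBlock z false (suc a) ++ letterBlock false o (suc a) ≡ letterBlock z o (2 * suc a)
letterBlock-double z o a rewrite +-identityʳ a = double z o
  where
  x = suc a
  regroup : ∀ c → bit false ∷ bit false ∷ bit true ∷ (repeatWord w1001 c ++ w1010) ≡ repeatWord w0011 (suc c) ++ w010
  regroup zero    = refl
  regroup (suc c) = cong (λ r → bit false ∷ bit false ∷ bit true ∷ bit true ∷ r) (regroup c)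
  double : ∀ z o → letterBlock z false x ++ letterBlock false o x ≡ letterBlock z o (x + x)
  double false false = sym (repeatWord-+ w1001 x x)
  double true  false = cong (λ r → end ∷ bit false ∷ bit false ∷ bit true ∷ r) (sym (repeatWord-+ w1001 a x))
  double false true  = begin
    repeatWord w1001 x ++ (repeatWord w1001 a ++ w1010)
      ≡⟨ sym (List.++-assoc (repeatWord w1001 x) (repeatWord w1001 a) w1010) ⟩
    (repeatWord w1001 x ++ repeatWord w1001 a) ++ w1010
      ≡⟨ cong (_++ w1010) (sym (repeatWord-+ w1001 x a)) ⟩
    repeatWord w1001 (x + a) ++ w1010
      ≡⟨ cong (λ c → repeatWord w1001 c ++ w1010) (sym (+-suc a a)) ⟩
    repeatWord w1001 (a + x) ++ w1010 ∎
    where open ≡-Reasoning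
  double true  true  = cong (end ∷_) (begin
    bit false ∷ bit false ∷ bit true ∷ (repeatWord w1001 a ++ repeatWord w1001 a ++ w1010)
      ≡⟨ cong (λ r → bit false ∷ bit false ∷ bit true ∷ r)
              (trans (sym (List.++-assoc (repeatWord w1001 a) (repeatWord w1001 a) w1010))
                     (cong (_++ w1010) (sym (repeatWord-+ w1001 a a)))) ⟩
    bit false ∷ bit false ∷ bit true ∷ (repeatWord w1001 (a + a) ++ w1010)
      ≡⟨ regroup (a + a) ⟩
    repeatWord w0011 (suc (a + a)) ++ w010
      ≡⟨ cong (λ c → repeatWord w0011 c ++ w010) (sym (+-suc a a)) ⟩
    repeatWord w0011 (a + x) ++ w010 ∎)
    where open ≡-Reasoning

map-letterBefore′-allWords : ∀ j z o → map (letterBefore′ z o) (allWords (suc (suc j))) ≡ letterBlock z o (2 ^ j)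
map-letterBefore′-allWords zero    false false = refl
map-letterBefore′-allWords zero    false true  = refl
map-letterBefore′-allWords zero    true  false = refl
map-letterBefore′-allWords zero    true  true  = refl
map-letterBefore′-allWords (suc j) z o = begin
  map (letterBefore′ z o) (map (false ∷_) W ++ map (true ∷_) W)
    ≡⟨ List.map-++ (letterBefore′ z o) (map (false ∷_) W) _ ⟩
  map (letterBefore′ z o) (map (false ∷_) W) ++ map (letterBefore′ z o) (map (true ∷_) W)
    ≡⟨ cong₂ _++_ (trans (drop-first false) (cong₂ (λ z′ o′ → map (letterBefore′ z′ o′) W) (∧-identityʳ z) (∧-zeroʳ o)))
                  (trans (drop-first true)  (cong₂ (λ z′ o′ → map (letterBefore′ z′ o′) W) (∧-zeroʳ z) (∧-identityʳ o))) ⟩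
  map (letterBefore′ z false) W ++ map (letterBefore′ false o) W
    ≡⟨ cong₂ _++_ (map-letterBefore′-allWords j z false) (map-letterBefore′-allWords j false o) ⟩
  letterBlock z false (2 ^ j) ++ letterBlock false o (2 ^ j)
    ≡⟨ double (2 ^ j) (m^n>0 2 j) ⟩
  letterBlock z o (2 ^ suc j) ∎
  where
  open ≡-Reasoning
  W = allWords (suc (suc j))
  drop-first : ∀ c → map (letterBefore′ z o) (map (c ∷_) W) ≡ map (letterBefore′ (z ∧ not c) (o ∧ c)) W
  drop-first c = trans (sym (List.map-∘ W)) (List.map-cong-local (All.tabulate λ {v} v∈ → step v (length-∈-allWords _ v∈)))
    where
    step : ∀ v → length v ≡ suc (suc j) → letterBefore′ z o (c ∷ v) ≡ letterBefore′ (z ∧ not c) (o ∧ c) v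
    step (_ ∷ _ ∷ _) _ = refl
  double : ∀ x → 0 < x → letterBlock z false x ++ letterBlock false o x ≡ letterBlock z o (2 * x)
  double (suc a) _ = letterBlock-double z o a

letterBefore′-closed : ∀ z o j v → length v ≡ suc (suc j) →
  letterBefore′ z o v ≡ (if z ∧ allZero v then end
                         else bit (not (nth false v (suc j) xor nth false v j) xor (o ∧ and (take (suc j) v))))
letterBefore′-closed z o zero    (false ∷ false ∷ []) _ = refl
letterBefore′-closed z o zero    (false ∷ true  ∷ []) _ = refl
letterBefore′-closed z o zero    (true  ∷ false ∷ []) _ = refl
letterBefore′-closed z o zero    (true  ∷ true  ∷ []) _ = refl
letterBefore′-closed z o (suc j) (c ∷ a ∷ b ∷ r) e
  rewrite letterBefore′-closed (z ∧ not c) (o ∧ c) j (a ∷ b ∷ r) (suc-injective e)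
        | ∧-assoc z (not c) (allZero (a ∷ b ∷ r))
        | ∧-assoc o c (and (take (suc j) (a ∷ b ∷ r))) = refl

module Prefixes (m : ℕ) where

  private
    k : ℕ
    k = suc (suc m)

  -- The length-k prefix of the rotation of U U[0..k-2]$ that starts a letters before $.
  endPrefix : ℕ → List Sym
  endPrefix a = replicate a (bit false) ++ end ∷ replicate (suc m ∸ a) (bit false)

  -- Before 0^{k-1}$ stands the last letter 1 of U, before the other end-prefixes a letter of U[0..k-2] = 0^{k-1}.
  letterBefore : List Sym → Sym
  letterBefore xs = if containsEnd xs then bit (endPosition xs ≡ᵇ suc m) else letterBefore′ true true (toBits xs)

  prefixes : List (List Sym)
  prefixes = applyUpTo endPrefix k ++ words k

  endPrefix-< : ∀ i j → i < j → endPrefix i <ˡ endPrefix j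
  endPrefix-< i j = go i j
    where
    go : ∀ i j {y z} → i < j → lexLeq (replicate j (bit false) ++ end ∷ y) (replicate i (bit false) ++ end ∷ z) ≡ false
    go zero    (suc j) _       = refl
    go (suc i) (suc j) (s≤s p) = go i j p

  endPrefix-<-word : ∀ a v → a < length v → endPrefix a <ˡ map bit v
  endPrefix-<-word a v = go a v
    where
    go : ∀ a v {y} → a < length v → lexLeq (map bit v) (replicate a (bit false) ++ end ∷ y) ≡ false
    go zero    (false ∷ v) _       = refl
    go zero    (true ∷ v)  _       = refl
    go (suc a) (false ∷ v) (s≤s p) = go a v p
    go (suc a) (true ∷ v)  _       = refl

  prefixes-sorted : AllPairs _<ˡ_ prefixes
  prefixes-sorted = AllPairs.++⁺ (AllPairs.applyUpTo⁺₁ endPrefix k (λ i<j _ → endPrefix-< _ _ i<j))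
                                 (words-sorted k)
    (All.tabulate λ x∈ → All.tabulate λ y∈ → endPrefix-<-words x∈ y∈)
    where
    endPrefix-<-words : ∀ {x y} → x ∈ applyUpTo endPrefix k → y ∈ words k → x <ˡ y
    endPrefix-<-words x∈ y∈ with v , v∈ , refl ← ∈-map⁻ (map bit) y∈ | a , a<k , refl ← ∈-applyUpTo⁻ endPrefix x∈ =
      endPrefix-<-word a v (subst (a <_) (sym (length-∈-allWords _ v∈)) a<k)

  containsEnd-endPrefix : ∀ a → containsEnd (endPrefix a) ≡ true
  containsEnd-endPrefix a = go a
    where
    go : ∀ a {y} → containsEnd (replicate a (bit false) ++ end ∷ y) ≡ true
    go zero    = refl
    go (suc a) = go a

  endPosition-endPrefix : ∀ a → endPosition (endPrefix a) ≡ a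
  endPosition-endPrefix a = go a
    where
    go : ∀ a {y} → endPosition (replicate a (bit false) ++ end ∷ y) ≡ a
    go zero    = refl
    go (suc a) = cong suc (go a)

  letterBefore-endPrefix : ∀ a → letterBefore (endPrefix a) ≡ bit (a ≡ᵇ suc m)
  letterBefore-endPrefix a rewrite containsEnd-endPrefix a | endPosition-endPrefix a = refl

  letterBefore-word : ∀ v → letterBefore (map bit v) ≡ letterBefore′ true true v
  letterBefore-word v rewrite containsEnd-map-bit v | toBits-map-bit v = refl

  map-letterBefore-prefixes : map letterBefore prefixes ≡ target k
  map-letterBefore-prefixes = begin
    map letterBefore (applyUpTo endPrefix k ++ words k)
      ≡⟨ List.map-++ letterBefore (applyUpTo endPrefix k) (words k) ⟩
    map letterBefore (applyUpTo endPrefix k) ++ map letterBefore (words k)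
      ≡⟨ cong₂ _++_ (trans (List.map-applyUpTo endPrefix letterBefore k) (applyUpTo-cong letterBefore-endPrefix k))
                    (trans (sym (List.map-∘ (allWords k))) (List.map-cong letterBefore-word (allWords k))) ⟩
    applyUpTo (λ a → bit (a ≡ᵇ suc m)) k ++ map (letterBefore′ true true) (allWords k)
      ≡⟨ cong₂ _++_ (applyUpTo-≡ᵇ (suc m)) (map-letterBefore′-allWords m true true) ⟩
    (replicate (suc m) (bit false) ++ [ bit true ]) ++ letterBlock true true (2 ^ m)
      ≡⟨ List.++-assoc (replicate (suc m) (bit false)) [ bit true ] _ ⟩
    target k ∎
    where open ≡-Reasoning

  length-endPrefix : ∀ b → b ≤ suc m → length (endPrefix b) ≡ k
  length-endPrefix b b≤ = begin
    length (replicate b (bit false) ++ end ∷ replicate (suc m ∸ b) (bit false))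
      ≡⟨ List.length-++ (replicate b (bit false)) ⟩
    length (replicate b (bit false)) + suc (length (replicate (suc m ∸ b) (bit false)))
      ≡⟨ cong₂ (λ x z → x + suc z) (List.length-replicate b) (List.length-replicate (suc m ∸ b)) ⟩
    b + suc (suc m ∸ b)
      ≡⟨ +-suc b (suc m ∸ b) ⟩
    suc (b + (suc m ∸ b))
      ≡⟨ cong suc (m+[n∸m]≡n b≤) ⟩
    suc (suc m) ∎
    where open ≡-Reasoning

  nth-endPrefix-< : ∀ b q → q < b → nth end (endPrefix b) q ≡ bit false
  nth-endPrefix-< b q q<b = trans (nth-++ˡ end (replicate b (bit false)) _ q (subst (q <_) (sym (List.length-replicate b)) q<b))
                                  (nth-replicate end (bit false) b q q<b)

  nth-endPrefix-≡ : ∀ b → nth end (endPrefix b) b ≡ end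
  nth-endPrefix-≡ b = trans (cong (nth end (endPrefix b)) (sym (trans (+-identityʳ _) (List.length-replicate b))))
                            (nth-++ʳ end (replicate b (bit false)) _ 0)

  nth-endPrefix-> : ∀ b q → b < q → q < k → nth end (endPrefix b) q ≡ bit false
  nth-endPrefix-> b q b<q q<k = begin
    nth end (endPrefix b) q
      ≡⟨ nth-++ʳ-∸ end (replicate b (bit false)) _ q (subst (_≤ q) (sym (List.length-replicate b)) (<⇒≤ b<q)) ⟩
    nth end (end ∷ replicate (suc m ∸ b) (bit false)) (q ∸ length (replicate b (bit false)))
      ≡⟨ cong (nth end (end ∷ replicate (suc m ∸ b) (bit false))) q∸b≡ ⟩
    nth end (replicate (suc m ∸ b) (bit false)) e
      ≡⟨ nth-replicate end (bit false) (suc m ∸ b) e e< ⟩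
    bit false ∎
    where
    open ≡-Reasoning
    e = q ∸ suc b
    q≡ : q ≡ suc b + e
    q≡ = sym (m+[n∸m]≡n b<q)
    q∸b≡ : q ∸ length (replicate b (bit false)) ≡ suc e
    q∸b≡ = trans (cong (q ∸_) (List.length-replicate b))
                 (trans (cong (_∸ b) (trans q≡ (cong suc (+-comm b e)))) (m+n∸n≡m (suc e) b))
    e< : e < suc m ∸ b
    e< = +-cancelˡ-< b e (suc m ∸ b)
           (subst (b + e <_) (sym (m+[n∸m]≡n (<⇒≤ (≤-trans b<q (≤-pred q<k))))) (≤-pred (subst (_< k) q≡ q<k)))

-- The BWT of U U[0..k-2]$

-- When the length-j prefixes of the rotations are distinct, sorting the rotations sorts their
-- prefixes, so a last column that is a function of the prefix is that function mapped over them.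
bwt-by-prefixes : ∀ W j (G : List Sym → Sym) (P : List (List Sym)) → AllPairs _<ˡ_ P →
  Unique (map (take j) (rotations W)) →
  (∀ {x} → x ∈ map (take j) (rotations W) → x ∈ P) → (∀ {x} → x ∈ P → x ∈ map (take j) (rotations W)) →
  (∀ {r} → r ∈ rotations W → lastS r ≡ G (take j r)) →
  BWT W ≡ map G P
bwt-by-prefixes W j G P P↗ distinct ⊆P ⊇P last = begin
  map lastS (isort R)
    ≡⟨ List.map-cong-local (All.tabulate λ r∈ → last (∈-isort⁻ R r∈)) ⟩
  map (G ∘ take j) (isort R)
    ≡⟨ List.map-∘ (isort R) ⟩
  map G (map (take j) (isort R))
    ≡⟨ cong (map G) (sorted-unique _ P sorted (isort-unique-map (take j) R distinct) P↗ ⊆ ⊇) ⟩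
  map G P ∎
  where
  open ≡-Reasoning
  R = rotations W
  sorted : AllPairs _≤ˡ_ (map (take j) (isort R))
  sorted = AllPairs.map⁺ (AllPairs.map (λ {x} {y} → ≤ˡ-take j x y) (isort-sorted R))
  ⊆ : ∀ {x} → x ∈ map (take j) (isort R) → x ∈ P
  ⊆ x∈ with r , r∈ , refl ← ∈-map⁻ (take j) x∈ = ⊆P (∈-map⁺ (take j) (∈-isort⁻ R r∈))
  ⊇ : ∀ {x} → x ∈ P → x ∈ map (take j) (isort R)
  ⊇ x∈ with r , r∈ , refl ← ∈-map⁻ (take j) (⊇P x∈) = ∈-map⁺ (take j) (∈-isort⁺ R r∈)

module Main (m : ℕ) (prim : Primitive (suc (suc m)) (T (suc (suc m))))
            (i : ℕ) (i<n : i < 2 ^ suc (suc m))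
            (U-start : take (suc (suc m)) (rotate i (M (suc (suc m)))) ≡ replicate (suc (suc m)) false) where

  open Primitivity m prim
  open Prefixes m

  d : ℕ → Bool
  d = s k

  y-window : ∀ t j → j < k → nth false (y t) j ≡ d (t + j)
  y-window t j j<k = begin
    nth false (y t) j
      ≡⟨ cong (λ z → nth false z j) (iter-cong F'≡fsr t _) ⟩
    nth false (iter t (fsr deBruijnFeedback) (replicate k false)) j
      ≡⟨ iter-fsr-window deBruijnFeedback (replicate k false) t j (subst (j <_) (sym (List.length-replicate k)) j<k) ⟩
    headB (iter (t + j) (fsr deBruijnFeedback) (replicate k false))
      ≡⟨ cong headB (sym (iter-cong F'≡fsr (t + j) _)) ⟩
    d (t + j) ∎
    where open ≡-Reasoning

  length-y : ∀ t → length (y t) ≡ k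
  length-y t = trans (cong length (iter-cong F'≡fsr t _))
                     (trans (length-iter-fsr deBruijnFeedback t (replicate k false)) (List.length-replicate k))

  d-periodic : ∀ t → d (n + t) ≡ d t
  d-periodic t = cong headB (trans (cong y (+-comm n t)) (y-shift-period t))

  d-periodic-twice : ∀ t → d (t + (n + n)) ≡ d t
  d-periodic-twice t = trans (cong d (trans (+-comm t (n + n)) (+-assoc n n t))) (trans (d-periodic (n + t)) (d-periodic t))

  D≡ : D k ≡ applyUpTo d n
  D≡ = List.map-upTo (s k) n

  length-D : length (D k) ≡ n
  length-D = trans (cong length D≡) (List.length-applyUpTo d n)

  length-M : length (M k) ≡ n
  length-M = trans (List.length-map not (reverse (D k))) (trans (List.length-reverse (D k)) length-D)

  nth-M : ∀ x → x < n → nth false (M k) x ≡ not (d (n ∸ suc x))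
  nth-M x x<n = begin
    nth false (map not (reverse (D k))) x
      ≡⟨ nth-map false false not (reverse (D k)) x (subst (x <_) (sym (trans (List.length-reverse (D k)) length-D)) x<n) ⟩
    not (nth false (reverse (D k)) x)
      ≡⟨ cong not (nth-reverse false (D k) x (subst (x <_) (sym length-D) x<n)) ⟩
    not (nth false (D k) (length (D k) ∸ suc x))
      ≡⟨ cong (λ l → not (nth false (D k) (l ∸ suc x))) length-D ⟩
    not (nth false (D k) (n ∸ suc x))
      ≡⟨ cong (λ l → not (nth false l (n ∸ suc x))) D≡ ⟩
    not (nth false (applyUpTo d n) (n ∸ suc x))
      ≡⟨ cong not (nth-applyUpTo false d n (n ∸ suc x) (∸-monoʳ-< (s≤s z≤n) x<n)) ⟩
    not (d (n ∸ suc x)) ∎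
    where open ≡-Reasoning

  U : List Bool
  U = rotate i (M k)

  length-U : length U ≡ n
  length-U = trans (length-rotate i (M k) (subst (i ≤_) (sym length-M) (<⇒≤ i<n))) length-M

  r : ℕ
  r = N ∸ i

  n≡1+i+r : n ≡ suc (i + r)
  n≡1+i+r = trans n≡suc-N (cong suc (sym (m+[n∸m]≡n (≤-pred (subst (i <_) n≡suc-N i<n)))))

  -- X ≡ n - 1 - i (mod n), and is large enough that X ∸ j never truncates for j < 2n.
  X : ℕ
  X = r + (n + n)

  u : ℕ → Bool
  u j = not (d (X ∸ j))

  X∸j-unwrapped : ∀ j c → r ≡ j + c → X ∸ j ≡ c + (n + n)
  X∸j-unwrapped j c r≡ = ∸-≡ X j (c + (n + n))
    (trans (cong (_+ (n + n)) r≡) (shuffle j c (n + n)))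
    where
    shuffle : ∀ j c x → (j + c) + x ≡ (c + x) + j
    shuffle = solve-∀

  X∸j-wrapped : ∀ j e c → j ≡ suc (r + e) → n ≡ suc e + c → X ∸ j ≡ n + c
  X∸j-wrapped j e c j≡ n≡ = ∸-≡ X j (n + c) (begin
    r + (n + n)           ≡⟨ cong (λ z → r + (n + z)) n≡ ⟩
    r + (n + (suc e + c)) ≡⟨ shuffle r n e c ⟩
    (n + c) + suc (r + e) ≡⟨ cong ((n + c) +_) (sym j≡) ⟩
    (n + c) + j ∎)
    where
    open ≡-Reasoning
    shuffle : ∀ r n e c → r + (n + (suc e + c)) ≡ (n + c) + suc (r + e)
    shuffle = solve-∀

  nth-U-unwrapped : ∀ j → i + j < n → nth false U j ≡ u j
  nth-U-unwrapped j i+j<n = begin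
    nth false U j
      ≡⟨ nth-rotate-< false i (M k) j (subst (i + j <_) (sym length-M) i+j<n) ⟩
    nth false (M k) (i + j)
      ≡⟨ nth-M (i + j) i+j<n ⟩
    not (d c)
      ≡⟨ cong not (sym (d-periodic-twice c)) ⟩
    not (d (c + (n + n)))
      ≡⟨ cong (not ∘ d) (sym (X∸j-unwrapped j c r≡j+c)) ⟩
    u j ∎
    where
    open ≡-Reasoning
    c = n ∸ suc (i + j)
    r≡j+c : r ≡ j + c
    r≡j+c = +-cancelˡ-≡ i r (j + c) (suc-injective (begin
      suc (i + r)     ≡⟨ sym n≡1+i+r ⟩
      n               ≡⟨ sym (m+[n∸m]≡n i+j<n) ⟩
      suc (i + j) + c ≡⟨ cong suc (+-assoc i j c) ⟩
      suc (i + (j + c)) ∎))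

  nth-U-wrapped : ∀ j → j < n → n ≤ i + j → nth false U j ≡ u j
  nth-U-wrapped j j<n n≤i+j = begin
    nth false U j
      ≡⟨ nth-rotate-≥ false i (M k) j e (subst (i ≤_) (sym length-M) (<⇒≤ i<n))
                      (trans i+j≡n+e (cong (_+ e) (sym length-M))) e<i ⟩
    nth false (M k) e
      ≡⟨ nth-M e e<n ⟩
    not (d c)
      ≡⟨ cong not (sym (d-periodic c)) ⟩
    not (d (n + c))
      ≡⟨ cong (not ∘ d) (sym (X∸j-wrapped j e c j≡ (sym (m+[n∸m]≡n e<n)))) ⟩
    u j ∎
    where
    open ≡-Reasoning
    e = i + j ∸ n
    c = n ∸ suc e
    i+j≡n+e : i + j ≡ n + e
    i+j≡n+e = sym (m+[n∸m]≡n n≤i+j)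
    e<i : e < i
    e<i = +-cancelˡ-< n e i (subst (_< n + i) i+j≡n+e (subst (i + j <_) (+-comm i n) (+-monoʳ-< i j<n)))
    e<n : e < n
    e<n = <-trans e<i i<n
    j≡ : j ≡ suc (r + e)
    j≡ = +-cancelˡ-≡ i j (suc (r + e)) (begin
      i + j             ≡⟨ i+j≡n+e ⟩
      n + e             ≡⟨ cong (_+ e) n≡1+i+r ⟩
      suc (i + r) + e   ≡⟨ cong suc (+-assoc i r e) ⟩
      suc (i + (r + e)) ≡⟨ sym (+-suc i (r + e)) ⟩
      i + suc (r + e) ∎)

  nth-U : ∀ j → j < n → nth false U j ≡ u j
  nth-U j j<n with i + j <? n
  ... | yes i+j<n = nth-U-unwrapped j i+j<n
  ... | no  i+j≮n = nth-U-wrapped j j<n (≮⇒≥ i+j≮n)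

  k<n : k < n
  k<n = n<2^n k
    where
    n<2^n : ∀ j → j < 2 ^ j
    n<2^n zero    = s≤s z≤n
    n<2^n (suc j) = subst (_< 2 ^ suc j) (+-comm j 1) (+-mono-<-≤ (n<2^n j) (subst (1 ≤_) (sym (+-identityʳ (2 ^ j))) (m^n>0 2 j)))

  2n≤X : n + n ≤ X
  2n≤X = m≤n+m (n + n) r

  u-periodic : ∀ q → n + q ≤ X → u (n + q) ≡ u q
  u-periodic q n+q≤X = cong not (sym (trans (cong d X∸q≡) (d-periodic (X ∸ (n + q)))))
    where
    shuffle : ∀ n q c → n + q + c ≡ n + c + q
    shuffle = solve-∀
    X∸q≡ : X ∸ q ≡ n + (X ∸ (n + q))
    X∸q≡ = ∸-≡ X q _ (trans (sym (m+[n∸m]≡n n+q≤X)) (shuffle n q (X ∸ (n + q))))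

  u-initial : ∀ q → q < k → u q ≡ false
  u-initial q q<k = begin
    u q                             ≡⟨ sym (nth-U q (<-trans q<k k<n)) ⟩
    nth false U q                   ≡⟨ sym (nth-take false U k q q<k) ⟩
    nth false (take k U) q          ≡⟨ cong (λ l → nth false l q) U-start ⟩
    nth false (replicate k false) q ≡⟨ nth-replicate false false k q q<k ⟩
    false ∎
    where open ≡-Reasoning

  u-periodic-initial : ∀ q → q < k → u (n + q) ≡ false
  u-periodic-initial q q<k = trans (u-periodic q (≤-trans (+-monoʳ-≤ n (<⇒≤ (<-trans q<k k<n))) 2n≤X)) (u-initial q q<k)

  w : List Bool
  w = U ++ take (k ∸ 1) U

  length-take-U : length (take (suc m) U) ≡ suc m
  length-take-U = trans (List.length-take (suc m) U) (m≤n⇒m⊓n≡m (subst (suc m ≤_) (sym length-U) (<⇒≤ (<-trans (n<1+n (suc m)) k<n))))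

  w≡ : w ≡ applyUpTo u (n + suc m)
  w≡ = nth-ext false w (applyUpTo u (n + suc m)) (trans length-w (sym (List.length-applyUpTo u (n + suc m)))) entry
    where
    length-w : length w ≡ n + suc m
    length-w = trans (List.length-++ U) (cong₂ _+_ length-U length-take-U)
    entry : ∀ j → j < length w → nth false w j ≡ nth false (applyUpTo u (n + suc m)) j
    entry j j<w with j <? n
    ... | yes j<n = begin
      nth false w j ≡⟨ nth-++ˡ false U _ j (subst (j <_) (sym length-U) j<n) ⟩
      nth false U j ≡⟨ nth-U j j<n ⟩
      u j           ≡⟨ sym (nth-applyUpTo false u (n + suc m) j (subst (j <_) length-w j<w)) ⟩
      nth false (applyUpTo u (n + suc m)) j ∎
      where open ≡-Reasoning
    ... | no j≮n = begin
      nth false w j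
        ≡⟨ nth-++ʳ-∸ false U _ j (subst (_≤ j) (sym length-U) n≤j) ⟩
      nth false (take (suc m) U) (j ∸ length U)
        ≡⟨ cong (nth false (take (suc m) U)) (cong (j ∸_) length-U) ⟩
      nth false (take (suc m) U) (j ∸ n)
        ≡⟨ nth-take false U (suc m) (j ∸ n) j∸n<k-1 ⟩
      nth false U (j ∸ n)
        ≡⟨ nth-U (j ∸ n) (<-trans j∸n<k-1 (<-trans (n<1+n (suc m)) k<n)) ⟩
      u (j ∸ n)
        ≡⟨ sym (u-periodic (j ∸ n) (≤-trans (+-monoʳ-≤ n (<⇒≤ (<-trans j∸n<k-1 (<-trans (n<1+n (suc m)) k<n)))) 2n≤X)) ⟩
      u (n + (j ∸ n))
        ≡⟨ cong u (m+[n∸m]≡n n≤j) ⟩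
      u j
        ≡⟨ sym (nth-applyUpTo false u (n + suc m) j (subst (j <_) length-w j<w)) ⟩
      nth false (applyUpTo u (n + suc m)) j ∎
      where
      open ≡-Reasoning
      n≤j = ≮⇒≥ j≮n
      j∸n<k-1 : j ∸ n < suc m
      j∸n<k-1 = +-cancelˡ-< n (j ∸ n) (suc m) (subst (_< n + suc m) (sym (m+[n∸m]≡n n≤j)) (subst (j <_) length-w j<w))

  window : ℕ → List Bool
  window p = applyUpTo (λ q → u (p + q)) k

  length-window : ∀ p → length (window p) ≡ k
  length-window p = List.length-applyUpTo (λ q → u (p + q)) k

  nth-window : ∀ p q → q < k → nth false (window p) q ≡ u (p + q)
  nth-window p q = nth-applyUpTo false (λ q → u (p + q)) k q

  -- Read backwards and complemented, window p is the state y (X ∸ (p + k - 1)) of the register.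
  y-window-u : ∀ p j → p + suc m ≤ X → j < k → nth false (y (X ∸ (p + suc m))) j ≡ not (u (p + (suc m ∸ j)))
  y-window-u p j p+k-1≤X j<k = begin
    nth false (y t) j         ≡⟨ y-window t j j<k ⟩
    d (t + j)                 ≡⟨ cong d (sym X∸≡t+j) ⟩
    d (X ∸ (p + (suc m ∸ j))) ≡⟨ sym (not-involutive _) ⟩
    not (u (p + (suc m ∸ j))) ∎
    where
    open ≡-Reasoning
    t = X ∸ (p + suc m)
    c = suc m ∸ j
    shuffle : ∀ t p c j → t + (p + (c + j)) ≡ t + j + (p + c)
    shuffle = solve-∀
    X∸≡t+j : X ∸ (p + c) ≡ t + j
    X∸≡t+j = ∸-≡ X (p + c) (t + j) (begin
      X                 ≡⟨ sym (m∸n+n≡m p+k-1≤X) ⟩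
      t + (p + suc m)   ≡⟨ cong (λ z → t + (p + z)) (sym (m∸n+n≡m (≤-pred j<k))) ⟩
      t + (p + (c + j)) ≡⟨ shuffle t p c j ⟩
      t + j + (p + c) ∎)

  window-fits : ∀ p → p ≤ n → p + suc m ≤ X
  window-fits p p≤n = ≤-trans (+-monoˡ-≤ (suc m) p≤n) (≤-trans (+-monoʳ-≤ n (<⇒≤ (<-trans (n<1+n (suc m)) k<n))) 2n≤X)

  window-injective : ∀ p p′ → p < p′ → p′ < n → window p ≢ window p′
  window-injective p p′ p<p′ p′<n h = y-injective t′ t t′<t t<t′+n (sym y-t≡y-t′)
    where
    fits′ = window-fits p′ (<⇒≤ p′<n)
    fits  = window-fits p (<⇒≤ (<-trans p<p′ p′<n))
    t  = X ∸ (p + suc m)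
    t′ = X ∸ (p′ + suc m)
    δ  = p′ ∸ p
    shuffle : ∀ t p δ s → t + (p + δ + s) ≡ t + δ + (p + s)
    shuffle = solve-∀
    t≡t′+δ : t ≡ t′ + δ
    t≡t′+δ = ∸-≡ X (p + suc m) (t′ + δ)
      (trans (sym (m∸n+n≡m fits′)) (trans (cong (λ z → t′ + (z + suc m)) (sym (m+[n∸m]≡n (<⇒≤ p<p′)))) (shuffle t′ p δ (suc m))))
    t′<t : t′ < t
    t′<t = subst (t′ <_) (sym t≡t′+δ) (subst (_< t′ + δ) (+-identityʳ t′) (+-monoʳ-< t′ (m<n⇒0<n∸m p<p′)))
    t<t′+n : t < t′ + n
    t<t′+n = subst (_< t′ + n) (sym t≡t′+δ) (+-monoʳ-< t′ (≤-<-trans (m∸n≤m p′ p) p′<n))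
    same-u : ∀ q → q < k → u (p + q) ≡ u (p′ + q)
    same-u q q<k = trans (sym (nth-window p q q<k)) (trans (cong (λ l → nth false l q) h) (nth-window p′ q q<k))
    y-t≡y-t′ : y t ≡ y t′
    y-t≡y-t′ = nth-ext false (y t) (y t′) (trans (length-y t) (sym (length-y t′))) λ j j<y →
      let j<k = subst (j <_) (length-y t) j<y in
      trans (y-window-u p j fits j<k)
            (trans (cong not (same-u (suc m ∸ j) (s≤s (m∸n≤m (suc m) j)))) (sym (y-window-u p′ j fits′ j<k)))

  nth-F'-last : ∀ x → length x ≡ k →
                nth false (F' x) (suc m) ≡ nth false x 0 xor (nth false x 1 xor (if allZero (drop 1 x) then true else false))
  nth-F'-last (x₀ ∷ x₁ ∷ r) e rewrite sym (suc-injective (suc-injective e)) =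
    trans (cong (λ z → nth false z (suc (length r))) (F'≡fsr (x₀ ∷ x₁ ∷ r))) (nth-fsr-last deBruijnFeedback x₀ x₁ r)

  allZero-state-tail : ∀ p → p + suc m ≤ X → allZero (drop 1 (y (X ∸ (p + suc m)))) ≡ and (take (suc m) (window p))
  allZero-state-tail p fits = begin
    allZero (drop 1 (y t))
      ≡⟨ allZero≡and-map-not (drop 1 (y t)) ⟩
    and (map not (drop 1 (y t)))
      ≡⟨ cong and (nth-ext false (map not (drop 1 (y t))) (reverse (take (suc m) (window p)))
                           (trans length-tail (sym length-rev)) entry) ⟩
    and (reverse (take (suc m) (window p)))
      ≡⟨ and-reverse (take (suc m) (window p)) ⟩
    and (take (suc m) (window p)) ∎
    where
    open ≡-Reasoning
    t = X ∸ (p + suc m)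
    length-take-window : length (take (suc m) (window p)) ≡ suc m
    length-take-window = trans (List.length-take (suc m) (window p)) (m≤n⇒m⊓n≡m (subst (suc m ≤_) (sym (length-window p)) (n≤1+n (suc m))))
    length-tail : length (map not (drop 1 (y t))) ≡ suc m
    length-tail = trans (List.length-map not (drop 1 (y t))) (trans (List.length-drop 1 (y t)) (cong (_∸ 1) (length-y t)))
    length-rev : length (reverse (take (suc m) (window p))) ≡ suc m
    length-rev = trans (List.length-reverse (take (suc m) (window p))) length-take-window
    entry : ∀ j → j < length (map not (drop 1 (y t))) →
            nth false (map not (drop 1 (y t))) j ≡ nth false (reverse (take (suc m) (window p))) j
    entry j j<l = begin
      nth false (map not (drop 1 (y t))) j
        ≡⟨ nth-map false false not (drop 1 (y t)) j (subst (j <_) (List.length-map not (drop 1 (y t))) j<l) ⟩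
      not (nth false (drop 1 (y t)) j)
        ≡⟨ cong not (nth-drop false (y t) 1 j) ⟩
      not (nth false (y t) (suc j))
        ≡⟨ cong not (y-window-u p (suc j) fits (s≤s j<k-1)) ⟩
      not (not (u (p + (m ∸ j))))
        ≡⟨ not-involutive _ ⟩
      u (p + (m ∸ j))
        ≡⟨ sym (nth-window p (m ∸ j) m∸j<k) ⟩
      nth false (window p) (m ∸ j)
        ≡⟨ sym (nth-take false (window p) (suc m) (m ∸ j) (s≤s (m∸n≤m m j))) ⟩
      nth false (take (suc m) (window p)) (m ∸ j)
        ≡⟨ cong (nth false (take (suc m) (window p))) (cong (_∸ suc j) (sym length-take-window)) ⟩
      nth false (take (suc m) (window p)) (length (take (suc m) (window p)) ∸ suc j)
        ≡⟨ sym (nth-reverse false (take (suc m) (window p)) j (subst (j <_) (sym length-take-window) j<k-1)) ⟩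
      nth false (reverse (take (suc m) (window p))) j ∎
      where
      j<k-1 : j < suc m
      j<k-1 = subst (j <_) length-tail j<l
      m∸j<k : m ∸ j < k
      m∸j<k = <-trans (s≤s (m∸n≤m m j)) (n<1+n (suc m))

  -- Running the register F' backwards: each letter of U is determined by the window that follows it.
  u-before-window : ∀ p → suc p ≤ n →
    u p ≡ not (u (suc p + suc m) xor u (suc p + m)) xor and (take (suc m) (window (suc p)))
  u-before-window p p<n = begin
    u p
      ≡⟨ cong (not ∘ d) X∸p≡t+k ⟩
    not (d (t + k))
      ≡⟨ cong (not ∘ d) (+-suc t (suc m)) ⟩
    not (d (suc t + suc m))
      ≡⟨ cong not (sym (y-window (suc t) (suc m) ≤-refl)) ⟩
    not (nth false (F' (y t)) (suc m))
      ≡⟨ cong not (nth-F'-last (y t) (length-y t)) ⟩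
    not (nth false (y t) 0 xor (nth false (y t) 1 xor feedback))
      ≡⟨ cong not (cong₂ (λ a b → a xor (b xor feedback))
                         (y-window-u (suc p) 0 fits (s≤s z≤n)) (y-window-u (suc p) 1 fits (s≤s (s≤s z≤n)))) ⟩
    not (not (u (suc p + suc m)) xor (not (u (suc p + m)) xor feedback))
      ≡⟨ not-xor-not (u (suc p + suc m)) (u (suc p + m)) feedback ⟩
    not (u (suc p + suc m) xor u (suc p + m)) xor feedback
      ≡⟨ cong (not (u (suc p + suc m) xor u (suc p + m)) xor_) (if-true-false (allZero (drop 1 (y t)))) ⟩
    not (u (suc p + suc m) xor u (suc p + m)) xor allZero (drop 1 (y t))
      ≡⟨ cong (not (u (suc p + suc m) xor u (suc p + m)) xor_) (allZero-state-tail (suc p) fits) ⟩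
    not (u (suc p + suc m) xor u (suc p + m)) xor and (take (suc m) (window (suc p))) ∎
    where
    open ≡-Reasoning
    fits = window-fits (suc p) p<n
    t = X ∸ (suc p + suc m)
    feedback = if allZero (drop 1 (y t)) then true else false
    shuffle : ∀ t p s → t + (suc p + s) ≡ t + suc s + p
    shuffle = solve-∀
    X∸p≡t+k : X ∸ p ≡ t + k
    X∸p≡t+k = ∸-≡ X p (t + k) (trans (sym (m∸n+n≡m fits)) (shuffle t p (suc m)))

  u-N : u N ≡ true
  u-N = begin
    u N
      ≡⟨ u-before-window N (≤-reflexive (sym n≡suc-N)) ⟩
    not (u (suc N + suc m) xor u (suc N + m)) xor (u (suc N + 0) ∧ and (take m (applyUpTo (λ q → u (suc N + suc q)) (suc m))))
      ≡⟨ cong (λ z → not (u (z + suc m) xor u (z + m)) xor (u (z + 0) ∧ and (take m (applyUpTo (λ q → u (z + suc q)) (suc m)))))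
              (sym n≡suc-N) ⟩
    not (u (n + suc m) xor u (n + m)) xor (u (n + 0) ∧ rest)
      ≡⟨ cong₂ (λ a b → not (a xor b) xor (u (n + 0) ∧ rest))
               (u-periodic-initial (suc m) (n<1+n (suc m))) (u-periodic-initial m (<-trans (n<1+n m) (n<1+n (suc m)))) ⟩
    true xor (u (n + 0) ∧ rest)
      ≡⟨ cong (λ a → true xor (a ∧ rest)) (u-periodic-initial 0 (s≤s z≤n)) ⟩
    true ∎
    where
    open ≡-Reasoning
    rest = and (take m (applyUpTo (λ q → u (n + suc q)) (suc m)))

  Wl : List Sym
  Wl = withEnd w

  L : ℕ
  L = suc (n + suc m)

  length-w : length w ≡ n + suc m
  length-w = trans (cong length w≡) (List.length-applyUpTo u (n + suc m))

  length-map-bit-w : length (map bit w) ≡ n + suc m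
  length-map-bit-w = trans (List.length-map bit w) length-w

  length-Wl : length Wl ≡ L
  length-Wl = trans (List.length-++ (map bit w)) (trans (cong (_+ 1) length-map-bit-w) (+-comm (n + suc m) 1))

  nth-Wl : ∀ j → j < n + suc m → nth end Wl j ≡ bit (u j)
  nth-Wl j j<w = begin
    nth end Wl j
      ≡⟨ nth-++ˡ end (map bit w) [ end ] j (subst (j <_) (sym length-map-bit-w) j<w) ⟩
    nth end (map bit w) j
      ≡⟨ nth-map false end bit w j (subst (j <_) (sym length-w) j<w) ⟩
    bit (nth false w j)
      ≡⟨ cong (λ l → bit (nth false l j)) w≡ ⟩
    bit (nth false (applyUpTo u (n + suc m)) j)
      ≡⟨ cong bit (nth-applyUpTo false u (n + suc m) j j<w) ⟩
    bit (u j) ∎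
    where open ≡-Reasoning

  nth-Wl-end : nth end Wl (n + suc m) ≡ end
  nth-Wl-end = trans (cong (nth end Wl) (sym (trans (+-identityʳ _) length-map-bit-w))) (nth-++ʳ end (map bit w) [ end ] 0)

  rot : ℕ → List Sym
  rot p = rotate p Wl

  length-rot : ∀ p → p ≤ L → length (rot p) ≡ L
  length-rot p p≤L = trans (length-rotate p Wl (subst (p ≤_) (sym length-Wl) p≤L)) length-Wl

  nth-rot : ∀ p q → p + q < L → nth end (rot p) q ≡ nth end Wl (p + q)
  nth-rot p q p+q<L = nth-rotate-< end p Wl q (subst (p + q <_) (sym length-Wl) p+q<L)

  nth-rot-wrapped : ∀ p q e → p ≤ L → p + q ≡ L + e → e < p → nth end (rot p) q ≡ nth end Wl e
  nth-rot-wrapped p q e p≤L p+q≡ e<p =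
    nth-rotate-≥ end p Wl q e (subst (p ≤_) (sym length-Wl) p≤L) (trans p+q≡ (cong (_+ e) (sym length-Wl))) e<p

  lastS≡nth : ∀ xs → lastS xs ≡ nth end xs (length xs ∸ 1)
  lastS≡nth []          = refl
  lastS≡nth (a ∷ [])    = refl
  lastS≡nth (a ∷ b ∷ r) = lastS≡nth (b ∷ r)

  lastS-rot-zero : lastS (rot 0) ≡ end
  lastS-rot-zero = trans (lastS≡nth (rot 0)) (trans (cong (λ l → nth end (rot 0) (l ∸ 1)) (length-rot 0 z≤n))
                          (trans (nth-rot 0 (n + suc m) ≤-refl) nth-Wl-end))

  lastS-rot-suc : ∀ p → suc p < L → lastS (rot (suc p)) ≡ nth end Wl p
  lastS-rot-suc p p<L = trans (lastS≡nth (rot (suc p)))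
    (trans (cong (λ l → nth end (rot (suc p)) (l ∸ 1)) (length-rot (suc p) (<⇒≤ p<L)))
           (nth-rot-wrapped (suc p) (n + suc m) p (<⇒≤ p<L) (cong suc (+-comm p (n + suc m))) ≤-refl))

  prefix : ℕ → List Sym
  prefix p = take k (rot p)

  length-prefix : ∀ p → p ≤ L → length (prefix p) ≡ k
  length-prefix p p≤L = trans (List.length-take k (rot p)) (m≤n⇒m⊓n≡m (subst (k ≤_) (sym (length-rot p p≤L)) k≤L))
    where k≤L = ≤-trans (<⇒≤ k<n) (≤-trans (m≤m+n n (suc m)) (n≤1+n _))

  prefix-window : ∀ p → p < n → prefix p ≡ map bit (window p)
  prefix-window p p<n = nth-ext end (prefix p) (map bit (window p))
    (trans (length-prefix p p≤L) (sym (trans (List.length-map bit (window p)) (length-window p)))) entry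
    where
    p≤L = ≤-trans (<⇒≤ p<n) (≤-trans (m≤m+n n (suc m)) (n≤1+n _))
    entry : ∀ q → q < length (prefix p) → nth end (prefix p) q ≡ nth end (map bit (window p)) q
    entry q q<l = begin
      nth end (prefix p) q
        ≡⟨ nth-take end (rot p) k q q<k ⟩
      nth end (rot p) q
        ≡⟨ nth-rot p q (<-trans p+q<w (n<1+n _)) ⟩
      nth end Wl (p + q)
        ≡⟨ nth-Wl (p + q) p+q<w ⟩
      bit (u (p + q))
        ≡⟨ cong bit (sym (nth-window p q q<k)) ⟩
      bit (nth false (window p) q)
        ≡⟨ sym (nth-map false end bit (window p) q (subst (q <_) (sym (length-window p)) q<k)) ⟩
      nth end (map bit (window p)) q ∎
      where
      open ≡-Reasoning
      q<k = subst (q <_) (length-prefix p p≤L) q<l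
      p+q<w : p + q < n + suc m
      p+q<w = +-mono-<-≤ p<n (≤-pred q<k)

  -- Rotation n + a starts k - 1 - a letters before $: zeros, then $, then the zeros that begin w.
  nth-rot-before-end : ∀ a q → a + q < suc m → nth end (rot (n + a)) q ≡ bit false
  nth-rot-before-end a q a+q<k-1 = begin
    nth end (rot (n + a)) q
      ≡⟨ nth-rot (n + a) q (<-trans n+a+q<w (n<1+n _)) ⟩
    nth end Wl (n + a + q)
      ≡⟨ nth-Wl (n + a + q) n+a+q<w ⟩
    bit (u (n + a + q))
      ≡⟨ cong (bit ∘ u) (+-assoc n a q) ⟩
    bit (u (n + (a + q)))
      ≡⟨ cong bit (u-periodic-initial (a + q) (<-trans a+q<k-1 (n<1+n (suc m)))) ⟩
    bit false ∎
    where
    open ≡-Reasoning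
    n+a+q<w : n + a + q < n + suc m
    n+a+q<w = subst (_< n + suc m) (sym (+-assoc n a q)) (+-monoʳ-< n a+q<k-1)

  nth-rot-at-end : ∀ a b → a + b ≡ suc m → nth end (rot (n + a)) b ≡ end
  nth-rot-at-end a b a+b≡ = begin
    nth end (rot (n + a)) b ≡⟨ nth-rot (n + a) b (subst (_< L) (sym n+a+b≡) ≤-refl) ⟩
    nth end Wl (n + a + b)  ≡⟨ cong (nth end Wl) n+a+b≡ ⟩
    nth end Wl (n + suc m)  ≡⟨ nth-Wl-end ⟩
    end ∎
    where
    open ≡-Reasoning
    n+a+b≡ : n + a + b ≡ n + suc m
    n+a+b≡ = trans (+-assoc n a b) (cong (n +_) a+b≡)

  nth-rot-after-end : ∀ a b q → a + b ≡ suc m → b < q → q < k → nth end (rot (n + a)) q ≡ bit false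
  nth-rot-after-end a b q a+b≡ b<q q<k = begin
    nth end (rot (n + a)) q ≡⟨ nth-rot-wrapped (n + a) q e n+a≤L n+a+q≡ e<n+a ⟩
    nth end Wl e            ≡⟨ nth-Wl e (≤-trans (<-trans e<k k<n) (m≤m+n n (suc m))) ⟩
    bit (u e)               ≡⟨ cong bit (u-initial e e<k) ⟩
    bit false ∎
    where
    open ≡-Reasoning
    e = q ∸ suc b
    q≡ : q ≡ suc b + e
    q≡ = sym (m+[n∸m]≡n b<q)
    e<k : e < k
    e<k = <-trans (≤-<-trans (m≤n+m e b) (≤-pred (subst (_< k) q≡ q<k))) (n<1+n (suc m))
    n+a≤L : n + a ≤ L
    n+a≤L = ≤-trans (+-monoʳ-≤ n (subst (a ≤_) a+b≡ (m≤m+n a b))) (n≤1+n _)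
    e<n+a : e < n + a
    e<n+a = ≤-trans (<-trans e<k k<n) (m≤m+n n a)
    shuffle : ∀ n a b e → n + a + (suc b + e) ≡ suc (n + (a + b) + e)
    shuffle = solve-∀
    n+a+q≡ : n + a + q ≡ L + e
    n+a+q≡ = trans (cong (n + a +_) q≡) (trans (shuffle n a b e) (cong (λ z → suc (n + z + e)) a+b≡))

  prefix-endPrefix : ∀ a → a < k → prefix (n + a) ≡ endPrefix (suc m ∸ a)
  prefix-endPrefix a a<k = nth-ext end (prefix (n + a)) (endPrefix b)
    (trans (length-prefix (n + a) n+a≤L) (sym (length-endPrefix b (m∸n≤m (suc m) a)))) entry
    where
    b = suc m ∸ a
    a+b≡ : a + b ≡ suc m
    a+b≡ = m+[n∸m]≡n (≤-pred a<k)
    n+a≤L : n + a ≤ L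
    n+a≤L = ≤-trans (+-monoʳ-≤ n (≤-pred a<k)) (n≤1+n _)
    entry : ∀ q → q < length (prefix (n + a)) → nth end (prefix (n + a)) q ≡ nth end (endPrefix b) q
    entry q q<l with q<k ← subst (q <_) (length-prefix (n + a) n+a≤L) q<l =
      trans (nth-take end (rot (n + a)) k q q<k) (compare (<-cmp q b))
      where
      compare : Tri (q < b) (q ≡ b) (b < q) → nth end (rot (n + a)) q ≡ nth end (endPrefix b) q
      compare (tri< q<b _ _)   =
        trans (nth-rot-before-end a q (subst (a + q <_) a+b≡ (+-monoʳ-< a q<b))) (sym (nth-endPrefix-< b q q<b))
      compare (tri≈ _ refl _)  = trans (nth-rot-at-end a b a+b≡) (sym (nth-endPrefix-≡ b))
      compare (tri> _ _ b<q)   = trans (nth-rot-after-end a b q a+b≡ b<q q<k) (sym (nth-endPrefix-> b q b<q q<k))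

  window-zero : window 0 ≡ replicate k false
  window-zero = nth-ext false (window 0) (replicate k false) (trans (length-window 0) (sym (List.length-replicate k))) λ q q<l →
    let q<k = subst (q <_) (length-window 0) q<l in
    trans (nth-window 0 q q<k) (trans (u-initial q q<k) (sym (nth-replicate false false k q q<k)))

  letterBefore-window : ∀ p → letterBefore (map bit (window p)) ≡
    (if allZero (window p) then end else bit (not (u (p + suc m) xor u (p + m)) xor and (take (suc m) (window p))))
  letterBefore-window p = begin
    letterBefore (map bit (window p))
      ≡⟨ letterBefore-word (window p) ⟩
    letterBefore′ true true (window p)
      ≡⟨ letterBefore′-closed true true m (window p) (length-window p) ⟩
    (if allZero (window p) then end else bit (not (nth false (window p) (suc m) xor nth false (window p) m) xor and (take (suc m) (window p))))
      ≡⟨ cong₂ (λ a b → if allZero (window p) then end else bit (not (a xor b) xor and (take (suc m) (window p))))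
               (nth-window p (suc m) ≤-refl) (nth-window p m (<-trans (n<1+n m) (n<1+n (suc m)))) ⟩
    (if allZero (window p) then end else bit (not (u (p + suc m) xor u (p + m)) xor and (take (suc m) (window p)))) ∎
    where open ≡-Reasoning

  window-nonzero : ∀ p → 0 < p → p < n → allZero (window p) ≡ false
  window-nonzero p 0<p p<n with allZero (window p) in zero?
  ... | false = refl
  ... | true  = ⊥-elim (window-injective 0 p 0<p p<n (trans window-zero (sym window-p≡0)))
    where
    window-p≡0 : window p ≡ replicate k false
    window-p≡0 = trans (allZero⇒replicate (window p) zero?) (cong (λ l → replicate l false) (length-window p))

  lastS-rot-window : ∀ p → p < n → lastS (rot p) ≡ letterBefore (prefix p)
  lastS-rot-window p p<n = trans (last p p<n) (sym (trans (cong letterBefore (prefix-window p p<n)) (letterBefore-window p)))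
    where
    last : ∀ p → p < n → lastS (rot p) ≡
      (if allZero (window p) then end else bit (not (u (p + suc m) xor u (p + m)) xor and (take (suc m) (window p))))
    last zero    _   rewrite trans (cong allZero window-zero) (allZero-replicate k) = lastS-rot-zero
    last (suc p) p<n rewrite window-nonzero (suc p) (s≤s z≤n) p<n = begin
      lastS (rot (suc p)) ≡⟨ lastS-rot-suc p (<-trans p<n (s≤s (m≤m+n n (suc m)))) ⟩
      nth end Wl p        ≡⟨ nth-Wl p (<-trans (n<1+n p) (≤-trans p<n (m≤m+n n (suc m)))) ⟩
      bit (u p)           ≡⟨ cong bit (u-before-window p (<⇒≤ p<n)) ⟩
      bit (not (u (suc p + suc m) xor u (suc p + m)) xor and (take (suc m) (window (suc p)))) ∎
      where open ≡-Reasoning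

  lastS-rot-end : ∀ a → a < k → lastS (rot (n + a)) ≡ letterBefore (prefix (n + a))
  lastS-rot-end a a<k rewrite prefix-endPrefix a a<k | letterBefore-endPrefix (suc m ∸ a) = last a a<k
    where
    last : ∀ a → a < k → lastS (rot (n + a)) ≡ bit ((suc m ∸ a) ≡ᵇ suc m)
    last zero _ rewrite ≡ᵇ-refl (suc m) = begin
      lastS (rot (n + 0))
        ≡⟨ cong (lastS ∘ rot) (trans (+-identityʳ n) n≡suc-N) ⟩
      lastS (rot (suc N))
        ≡⟨ lastS-rot-suc N (s≤s (≤-trans (≤-reflexive (sym n≡suc-N)) (m≤m+n n (suc m)))) ⟩
      nth end Wl N
        ≡⟨ nth-Wl N (≤-trans (≤-reflexive (sym n≡suc-N)) (m≤m+n n (suc m))) ⟩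
      bit (u N)
        ≡⟨ cong bit u-N ⟩
      bit true ∎
      where open ≡-Reasoning
    last (suc a) a<k rewrite <⇒≡ᵇ-false (m ∸ a) (suc m) (s≤s (m∸n≤m m a)) = begin
      lastS (rot (n + suc a))   ≡⟨ cong (lastS ∘ rot) (+-suc n a) ⟩
      lastS (rot (suc (n + a))) ≡⟨ lastS-rot-suc (n + a) (s≤s (+-monoʳ-< n (≤-pred a<k))) ⟩
      nth end Wl (n + a)        ≡⟨ nth-Wl (n + a) (+-monoʳ-< n (≤-pred a<k)) ⟩
      bit (u (n + a))           ≡⟨ cong bit (u-periodic-initial a (<-trans (n<1+n a) a<k)) ⟩
      bit false ∎
      where open ≡-Reasoning

  Position : ℕ → Set
  Position p = (p < n × prefix p ≡ map bit (window p)) ⊎ ∃ λ a → a < k × p ≡ n + a × prefix p ≡ endPrefix (suc m ∸ a)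

  position : ∀ p → p < L → Position p
  position p p<L with p <? n
  ... | yes p<n = inj₁ (p<n , prefix-window p p<n)
  ... | no  p≮n = inj₂ (a , a<k , p≡ , trans (cong prefix p≡) (prefix-endPrefix a a<k))
    where
    a = p ∸ n
    p≡ : p ≡ n + a
    p≡ = sym (m+[n∸m]≡n (≮⇒≥ p≮n))
    a<k : a < k
    a<k = +-cancelˡ-< n a k (subst (_< n + k) p≡ (subst (p <_) (sym (+-suc n (suc m))) p<L))

  lastS-rot : ∀ p → p < L → lastS (rot p) ≡ letterBefore (prefix p)
  lastS-rot p p<L with position p p<L
  ... | inj₁ (p<n , _)           = lastS-rot-window p p<n
  ... | inj₂ (a , a<k , refl , _) = lastS-rot-end a a<k

  window∈allWords : ∀ p → window p ∈ allWords k
  window∈allWords p = subst (λ l → window p ∈ allWords l) (length-window p) (∈-allWords (window p))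

  prefix∈prefixes : ∀ p → p < L → prefix p ∈ prefixes
  prefix∈prefixes p p<L with position p p<L
  ... | inj₁ (_ , e) = subst (_∈ prefixes) (sym e)
                         (∈-++⁺ʳ (applyUpTo endPrefix k) (∈-map⁺ (map bit) (window∈allWords p)))
  ... | inj₂ (a , _ , _ , e) = subst (_∈ prefixes) (sym e) (∈-++⁺ˡ (∈-applyUpTo⁺ endPrefix (s≤s (m∸n≤m (suc m) a))))

  prefix-injective : ∀ {a b} → a < b → b < L → prefix a ≢ prefix b
  prefix-injective {a} {b} a<b b<L e with position a (<-trans a<b b<L) | position b b<L
  ... | inj₁ (_ , ea) | inj₁ (b<n , eb) = window-injective a b a<b b<n (map-bit-injective (trans (sym ea) (trans e eb)))
  ... | inj₁ (_ , ea) | inj₂ (c , _ , _ , eb) =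
    true≢false (trans (sym (containsEnd-endPrefix (suc m ∸ c)))
                      (trans (cong containsEnd (trans (sym eb) (trans (sym e) ea))) (containsEnd-map-bit (window a))))
  ... | inj₂ (c , _ , refl , _) | inj₁ (b<n , _) = <-irrefl refl (<-trans (≤-<-trans (m≤m+n n c) a<b) b<n)
  ... | inj₂ (c , _ , refl , ea) | inj₂ (c′ , c′<k , refl , eb) = <-irrefl b-equal (∸-monoʳ-< (+-cancelˡ-< n c c′ a<b) (≤-pred c′<k))
    where
    b-equal : suc m ∸ c′ ≡ suc m ∸ c
    b-equal = trans (sym (endPosition-endPrefix (suc m ∸ c′)))
                    (trans (cong endPosition (trans (sym eb) (trans (sym e) ea))) (endPosition-endPrefix (suc m ∸ c)))

  -- There are n = 2ᵏ distinct windows, so they are all the words of length k.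
  windows-cover : ∀ {v} → v ∈ allWords k → ∃ λ p → p < n × v ≡ window p
  windows-cover v∈ = ∈-applyUpTo⁻ window
    (unique-⊆-length≡⇒⊇ (List.≡-dec _≟ᵇ_) (applyUpTo window n) (allWords k) (Unique.applyUpTo⁺₁ window n (window-injective _ _))
      (λ x∈ → let p , _ , x≡ = ∈-applyUpTo⁻ window x∈ in subst (_∈ allWords k) (sym x≡) (window∈allWords p))
      (trans (List.length-applyUpTo window n) (sym (length-allWords k))) v∈)

  prefixes-covered : ∀ {x} → x ∈ prefixes → ∃ λ p → p < L × x ≡ prefix p
  prefixes-covered x∈ with ∈-++⁻ (applyUpTo endPrefix k) x∈
  ... | inj₁ q with b , b<k , refl ← ∈-applyUpTo⁻ endPrefix q =
    n + (suc m ∸ b) , s≤s (+-monoʳ-≤ n (m∸n≤m (suc m) b)) ,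
    sym (trans (prefix-endPrefix (suc m ∸ b) (s≤s (m∸n≤m (suc m) b))) (cong endPrefix (m∸[m∸n]≡n (≤-pred b<k))))
  ... | inj₂ q with v , v∈ , refl ← ∈-map⁻ (map bit) q with p , p<n , refl ← windows-cover v∈ =
    p , ≤-trans p<n (≤-trans (m≤m+n n (suc m)) (n≤1+n _)) , sym (prefix-window p p<n)

  rotations≡ : rotations Wl ≡ applyUpTo rot L
  rotations≡ = trans (cong (λ l → map rot (upTo l)) length-Wl) (List.map-upTo rot L)

  map-take-rotations≡ : map (take k) (rotations Wl) ≡ applyUpTo prefix L
  map-take-rotations≡ = trans (cong (map (take k)) rotations≡) (List.map-applyUpTo rot (take k) L)

  bwt : BWT Wl ≡ target k
  bwt = trans (bwt-by-prefixes Wl k letterBefore prefixes prefixes-sorted distinct ⊆ ⊇ last) map-letterBefore-prefixes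
    where
    distinct : Unique (map (take k) (rotations Wl))
    distinct = subst Unique (sym map-take-rotations≡) (Unique.applyUpTo⁺₁ prefix L prefix-injective)
    ⊆ : ∀ {x} → x ∈ map (take k) (rotations Wl) → x ∈ prefixes
    ⊆ {x} x∈ with p , p<L , refl ← ∈-applyUpTo⁻ prefix (subst (x ∈_) map-take-rotations≡ x∈) = prefix∈prefixes p p<L
    ⊇ : ∀ {x} → x ∈ prefixes → x ∈ map (take k) (rotations Wl)
    ⊇ x∈ with p , p<L , refl ← prefixes-covered x∈ = subst (prefix p ∈_) (sym map-take-rotations≡) (∈-applyUpTo⁺ prefix p<L)
    last : ∀ {r} → r ∈ rotations Wl → lastS r ≡ letterBefore (take k r)
    last {r} r∈ with p , p<L , refl ← ∈-applyUpTo⁻ rot (subst (r ∈_) rotations≡ r∈) = lastS-rot p p<L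

runs-zeros : ∀ j r → runs (replicate (suc j) (bit false) ++ bit true ∷ r) ≡ suc (runs (bit true ∷ r))
runs-zeros zero    r = refl
runs-zeros (suc j) r = runs-zeros j r

runs-tail : ∀ a c → (a ==ˢ bit false) ≡ false → runs (a ∷ repeatWord w0011 c ++ w010) ≡ 2 * c + 4
runs-tail a zero    a≢0 rewrite a≢0 = refl
runs-tail a (suc c) a≢0 rewrite a≢0 = trans (cong (2 +_) (runs-tail (bit true) c refl)) (shuffle c)
  where
  shuffle : ∀ c → 2 + (2 * c + 4) ≡ 2 * suc c + 4
  shuffle = solve-∀

runs-target : ∀ m → runs (target (suc (suc m))) ≡ 2 ^ suc m + 4
runs-target m = begin
  runs (target (suc (suc m)))     ≡⟨ runs-zeros m (end ∷ tail) ⟩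
  suc (suc (runs (end ∷ tail)))   ≡⟨ cong (suc ∘ suc) (runs-tail end (2 ^ m ∸ 1) refl) ⟩
  suc (suc (2 * (2 ^ m ∸ 1) + 4)) ≡⟨ count (2 ^ m) (m^n>0 2 m) ⟩
  2 ^ suc m + 4 ∎
  where
  open ≡-Reasoning
  tail = repeatWord w0011 (2 ^ m ∸ 1) ++ w010
  shuffle : ∀ c → suc (suc (2 * c + 4)) ≡ 2 * suc c + 4
  shuffle = solve-∀
  count : ∀ x → 0 < x → suc (suc (2 * (x ∸ 1) + 4)) ≡ 2 * x + 4
  count (suc x) _ = shuffle x

lemma3 : (k : ℕ) → 2 ≤ k → Primitive k (T k) →
    (i : ℕ) → i < 2 ^ k → take k (rotate i (M k)) ≡ replicate k false →
    BWT (withEnd (rotate i (M k) ++ take (k ∸ 1) (rotate i (M k)))) ≡ target k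
    × runs (target k) ≡ 2 ^ (k ∸ 1) + 4
lemma3 (suc (suc m)) (s≤s (s≤s z≤n)) prim i i<n U-start = Main.bwt m prim i i<n U-start , runs-target m
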